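{- Let $r\ge 1$ be an integer. For $1\le j\le r$ define \[ c_{r,j}=(-1)^{r-1}\sum_{k=j}^{r}\frac{(-2)^{k-j}}{(k-1)!}\binom{r}{k}S(k,j) \] and \[ d_{r,j}=\sum_{\substack{j_1,\ldots,j_r\ge 0\\ j+2j_1+\cdots+2j_r=r}}\ \prod_{t=1}^{r}\frac{B_{2j_t}}{(2j_t)!}. \] Then for every $j$ with $1\le j\le r$ and $j\equiv r \pmod 2$, \[ c_{r,j}=\frac{(-1)^{r+1}2^{r-j}}{(j-1)!}\,d_{r,j}. \]
   Context: $S(k,j)$ is the unsigned Stirling number of the first kind (the number of permutations of $k$ objects with exactly $j$ cycles). $B_m$ denotes the $m$-th ordinary Bernoulli number (so $B_0=1$, $B_2=1/6$, \dots). The numbers $c_{r,j}$ are the coefficients in the identity of functions $i^r\cot^r=\frac{(-1)^r+1}{2}+\sum_{j=1}^r c_{r,j}\,i^j\cot_{j-1}$, where $\cot_l$ is the $l$-th derivative of $\cot$. -}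

module Defs where

open import Data.Nat as ℕ using (ℕ; zero; suc; _∸_; _!)
open import Data.Nat.Properties using (_!≢0)
open import Data.Nat.Combinatorics using (_C_)
open import Data.Integer using (ℤ; +_)
open import Data.Rational using (ℚ; _+_; _*_; -_; _/_; 0ℚ; 1ℚ)
open import Data.List using (List; []; _∷_; map; concatMap; upTo; filter; zipWith; reverse)
open import Data.Vec as Vec using (Vec)
import Data.Nat

ℕ→ℚ : ℕ → ℚ
ℕ→ℚ n = + n / 1

_^ℚ_ : ℚ → ℕ → ℚ
x ^ℚ zero = 1ℚ
x ^ℚ suc n = x * (x ^ℚ n)

invFact : ℕ → ℚ
invFact n = (+ 1 / (n !)) {{n !≢0}}

sumℚ : List ℚ → ℚ
sumℚ [] = 0ℚ
sumℚ (x ∷ xs) = x + sumℚ xs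

Σ[_⋯_] : ℕ → ℕ → (ℕ → ℚ) → ℚ
Σ[ a ⋯ b ] f = sumℚ (map (λ i → f (a Data.Nat.+ i)) (upTo (suc b ∸ a)))

-- unsigned Stirling numbers of the first kind, S(n,k) = # permutations of n objects with k cycles
S : ℕ → ℕ → ℕ
S zero zero = 1
S zero (suc k) = 0
S (suc n) zero = 0
S (suc n) (suc k) = n Data.Nat.* S n (suc k) Data.Nat.+ S n k

-- Bernoulli numbers B_0, …, B_n listed in REVERSE order (B_n first),
-- via B_0 = 1 and  Σ_{k=0}^{m} C(m+1,k) B_k = 0  for m ≥ 1.
bernRev : ℕ → List ℚ
bernRev zero = 1ℚ ∷ []
bernRev (suc n) = next ∷ prev
  where
  prev : List ℚ
  prev = bernRev n
  m : ℕ
  m = suc n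
  next : ℚ
  next = - ((+ 1 / suc m) * sumℚ (zipWith (λ k b → ℕ→ℚ (suc m C k) * b) (upTo m) (reverse prev)))

headℚ : List ℚ → ℚ
headℚ [] = 0ℚ
headℚ (x ∷ _) = x

-- ordinary Bernoulli number B_m (B_0 = 1, B_1 = -1/2, B_2 = 1/6, …)
B : ℕ → ℚ
B m = headℚ (bernRev m)

c : ℕ → ℕ → ℚ
c r j = ((- 1ℚ) ^ℚ (r ∸ 1)) *
  Σ[ j ⋯ r ] (λ k → ((- ℕ→ℚ 2) ^ℚ (k ∸ j)) * invFact (k ∸ 1) * ℕ→ℚ (r C k) * ℕ→ℚ (S k j))

box : (n : ℕ) → ℕ → List (Vec ℕ n)
box zero b = Vec.[] ∷ []
box (suc n) b = concatMap (λ i → map (i Vec.∷_) (box n b)) (upTo (suc b))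

vsum : ∀ {n} → Vec ℕ n → ℕ
vsum = Vec.foldr _ Data.Nat._+_ 0

vprodℚ : ∀ {n} → Vec ℚ n → ℚ
vprodℚ = Vec.foldr _ _*_ 1ℚ

-- index set { (j_1,…,j_r) ∈ ℕ^r : j + 2 j_1 + ⋯ + 2 j_r = r }
-- (each j_t ≤ r automatically, so enumerating the box [0,r]^r loses nothing)
tuples : (r j : ℕ) → List (Vec ℕ r)
tuples r j = filter (λ v → j Data.Nat.+ 2 Data.Nat.* vsum v Data.Nat.≟ r) (box r r)

d : ℕ → ℕ → ℚ
d r j = sumℚ (map (λ v → vprodℚ (Vec.map (λ i → B (2 Data.Nat.* i) * invFact (2 Data.Nat.* i)) v)) (tuples r j))

{-# OPTIONS --safe #-}
module Submission where

-- Let β(x) = x/(e^x - 1) = Σ B_n x^n/n! and h = β + x/2. From β·(e^x - 1) = x one gets the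
-- Riccati equation x h' = h - h² + x²/4. This equation is invariant under x ↦ -x and has a
-- unique power-series solution with constant term 1, so h is even: h = Σ B_2i x^2i/(2i)!.
-- Hence d_{r,j} is the coefficient of x^(r-j) in h^r, and applying x d/dx to x^(j+1) h^(r+1)
-- turns the Riccati equation into the recurrence
--   (r+1) d_{r+2,j+1} = j d_{r+1,j} + (r+1)/4 d_{r,j+1}.
-- On the other side, writing the sum defining c_{r,j} as a binomial transform, Pascal's rule
-- and the recurrence S(k+2,j+1) = (k+1) S(k+1,j+1) + S(k+1,j) give the matching recurrence
-- for c_{r,j}, and the identity follows by induction on r.

open import Defs
open import Data.Nat as ℕ using (ℕ; zero; suc; _!; _∸_; _≤_; _<_; z≤n; s≤s; NonZero; _%_)
import Data.Nat.Properties as ℕ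
open import Data.Nat.Combinatorics using (_C_)
import Data.Nat.Combinatorics as ℕC
import Data.Nat.Combinatorics.Specification as ℕC
import Data.Nat.DivMod as ℕ
open import Data.Nat.Induction using (<-rec)
import Data.Nat.Coprimality as Coprime
import Data.Integer as ℤ
import Data.Integer.Properties as ℤ
import Data.Sign as Sign
open import Data.Rational using (ℚ; mkℚ; 0ℚ; 1ℚ; _+_; _*_; -_; _/_)
import Data.Rational.Properties as ℚ
import Data.Rational.Solver as ℚ
open import Algebra.Properties.Group ℚ.+-0-group using (x∙y⁻¹≈ε⇒x≈y) renaming (∙-cancelʳ to +-cancelʳ)
open import Data.Bool using (if_then_else_; true; false)
open import Data.List using (List; []; _∷_; _++_; map; filter; concatMap; upTo; applyUpTo; applyDownFrom; zipWith; reverse)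
import Data.List.Properties as List
import Data.Vec as Vec
open import Data.Product using (_×_; _,_; proj₁; proj₂)
open import Data.Sum using (inj₁; inj₂)
open import Data.Maybe using (Maybe; just; nothing)
open import Function using (_∘_; id)
open import Level using (0ℓ)
open import Algebra.Bundles using (CommutativeRing)
open import Relation.Binary.Bundles using (Setoid)
open import Algebra.Solver.Ring.AlmostCommutativeRing using (fromCommutativeRing; _-Raw-AlmostCommutative⟶_)
import Algebra.Solver.Ring
open import Relation.Nullary using (does; yes; no)
open import Relation.Unary using (Decidable)
open import Relation.Binary.PropositionalEquality
open ≡-Reasoning

module ℚ-Solver = ℚ.+-*-Solver

ℕ→ℚ≡mkℚ : ∀ n → ℕ→ℚ n ≡ mkℚ (ℤ.+ n) 0 (Coprime.sym (Coprime.1-coprimeTo n))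
ℕ→ℚ≡mkℚ n = ℚ.normalize-coprime (Coprime.sym (Coprime.1-coprimeTo n))

ℕ→ℚ-suc : ∀ n → ℕ→ℚ (suc n) ≡ 1ℚ + ℕ→ℚ n
ℕ→ℚ-suc n = begin
  ℤ.+ suc n / 1                                               ≡⟨ cong (_/ 1) numerator ⟩
  (ℤ.+ 1 ℤ.+ (Sign.+ ℤ.◃ (n ℕ.* 1))) / 1                      ≡⟨⟩
  1ℚ + mkℚ (ℤ.+ n) 0 (Coprime.sym (Coprime.1-coprimeTo n))    ≡⟨ cong (1ℚ +_) (ℕ→ℚ≡mkℚ n) ⟨
  1ℚ + ℕ→ℚ n                                                  ∎
  where
  numerator : ℤ.+ suc n ≡ ℤ.+ 1 ℤ.+ (Sign.+ ℤ.◃ (n ℕ.* 1))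
  numerator = cong (λ z → ℤ.+ 1 ℤ.+ z) (sym (trans (ℤ.+◃n≡+n (n ℕ.* 1)) (cong ℤ.+_ (ℕ.*-identityʳ n))))

ℕ→ℚ-+ : ∀ m n → ℕ→ℚ (m ℕ.+ n) ≡ ℕ→ℚ m + ℕ→ℚ n
ℕ→ℚ-+ zero n = sym (ℚ.+-identityˡ (ℕ→ℚ n))
ℕ→ℚ-+ (suc m) n = begin
  ℕ→ℚ (suc (m ℕ.+ n))        ≡⟨ ℕ→ℚ-suc (m ℕ.+ n) ⟩
  1ℚ + ℕ→ℚ (m ℕ.+ n)         ≡⟨ cong (1ℚ +_) (ℕ→ℚ-+ m n) ⟩
  1ℚ + (ℕ→ℚ m + ℕ→ℚ n)       ≡⟨ ℚ.+-assoc 1ℚ (ℕ→ℚ m) (ℕ→ℚ n) ⟨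
  (1ℚ + ℕ→ℚ m) + ℕ→ℚ n       ≡⟨ cong (_+ ℕ→ℚ n) (ℕ→ℚ-suc m) ⟨
  ℕ→ℚ (suc m) + ℕ→ℚ n        ∎

ℕ→ℚ-* : ∀ m n → ℕ→ℚ (m ℕ.* n) ≡ ℕ→ℚ m * ℕ→ℚ n
ℕ→ℚ-* zero n = sym (ℚ.*-zeroˡ (ℕ→ℚ n))
ℕ→ℚ-* (suc m) n = begin
  ℕ→ℚ (n ℕ.+ m ℕ.* n)        ≡⟨ ℕ→ℚ-+ n (m ℕ.* n) ⟩
  ℕ→ℚ n + ℕ→ℚ (m ℕ.* n)      ≡⟨ cong (ℕ→ℚ n +_) (ℕ→ℚ-* m n) ⟩
  ℕ→ℚ n + ℕ→ℚ m * ℕ→ℚ n      ≡⟨ solve 2 (λ a b → b :+ a :* b := (con 1ℚ :+ a) :* b) refl (ℕ→ℚ m) (ℕ→ℚ n) ⟩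
  (1ℚ + ℕ→ℚ m) * ℕ→ℚ n       ≡⟨ cong (_* ℕ→ℚ n) (ℕ→ℚ-suc m) ⟨
  ℕ→ℚ (suc m) * ℕ→ℚ n        ∎
  where open ℚ-Solver

1/n*n≡1 : ∀ n .{{_ : NonZero n}} → (ℤ.+ 1 / n) * ℕ→ℚ n ≡ 1ℚ
1/n*n≡1 n@(suc m) = begin
  (ℤ.+ 1 / n) * ℕ→ℚ n                                    ≡⟨ cong₂ _*_ (ℚ.normalize-coprime 1⊥n) (ℕ→ℚ≡mkℚ n) ⟩
  mkℚ (ℤ.+ 1) m 1⊥n * mkℚ (ℤ.+ n) 0 (Coprime.sym 1⊥n)     ≡⟨ ℚ.*-inverseˡ (mkℚ (ℤ.+ n) 0 (Coprime.sym 1⊥n)) ⟩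
  1ℚ                                                     ∎
  where 1⊥n = Coprime.1-coprimeTo n

*-inverse-unique : ∀ {p q r : ℚ} → p * q ≡ 1ℚ → q * r ≡ 1ℚ → p ≡ r
*-inverse-unique {p} {q} {r} pq≡1 qr≡1 = begin
  p              ≡⟨ ℚ.*-identityʳ p ⟨
  p * 1ℚ         ≡⟨ cong (p *_) qr≡1 ⟨
  p * (q * r)    ≡⟨ ℚ.*-assoc p q r ⟨
  (p * q) * r    ≡⟨ cong (_* r) pq≡1 ⟩
  1ℚ * r         ≡⟨ ℚ.*-identityˡ r ⟩
  r              ∎

ℕ→ℚ-*-cancelˡ : ∀ n .{{_ : NonZero n}} {p q} → ℕ→ℚ n * p ≡ ℕ→ℚ n * q → p ≡ q
ℕ→ℚ-*-cancelˡ n@(suc _) {p} {q} eq = begin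
  p                      ≡⟨ ℚ.*-identityˡ p ⟨
  1ℚ * p                 ≡⟨ cong (_* p) (1/n*n≡1 n) ⟨
  1/n * ℕ→ℚ n * p        ≡⟨ ℚ.*-assoc 1/n (ℕ→ℚ n) p ⟩
  1/n * (ℕ→ℚ n * p)      ≡⟨ cong (1/n *_) eq ⟩
  1/n * (ℕ→ℚ n * q)      ≡⟨ ℚ.*-assoc 1/n (ℕ→ℚ n) q ⟨
  1/n * ℕ→ℚ n * q        ≡⟨ cong (_* q) (1/n*n≡1 n) ⟩
  1ℚ * q                 ≡⟨ ℚ.*-identityˡ q ⟩
  q                      ∎
  where 1/n = ℤ.+ 1 / n

invFact-*-! : ∀ n → invFact n * ℕ→ℚ (n !) ≡ 1ℚ
invFact-*-! n = 1/n*n≡1 (n !) {{n ℕ.!≢0}}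

!-*-invFact : ∀ n → ℕ→ℚ (n !) * invFact n ≡ 1ℚ
!-*-invFact n = trans (ℚ.*-comm (ℕ→ℚ (n !)) (invFact n)) (invFact-*-! n)

invFact-suc : ∀ n → invFact (suc n) * ℕ→ℚ (suc n) ≡ invFact n
invFact-suc n = *-inverse-unique (begin
  invFact (suc n) * ℕ→ℚ (suc n) * ℕ→ℚ (n !)     ≡⟨ ℚ.*-assoc (invFact (suc n)) _ _ ⟩
  invFact (suc n) * (ℕ→ℚ (suc n) * ℕ→ℚ (n !))   ≡⟨ cong (invFact (suc n) *_) (ℕ→ℚ-* (suc n) (n !)) ⟨
  invFact (suc n) * ℕ→ℚ (suc n !)               ≡⟨ invFact-*-! (suc n) ⟩
  1ℚ                                            ∎) (!-*-invFact n)

nCk*k!*[n∸k]!≡n! : ∀ {n k} → k ≤ n → (n C k) ℕ.* (k ! ℕ.* (n ∸ k) !) ≡ n !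
nCk*k!*[n∸k]!≡n! {n} {k} k≤n = begin
  (n C k) ℕ.* (k ! ℕ.* (n ∸ k) !)                      ≡⟨ cong (ℕ._* (k ! ℕ.* (n ∸ k) !)) (ℕC.nCk≡n!/k![n-k]! k≤n) ⟩
  (n ! ℕ./ (k ! ℕ.* (n ∸ k) !)) ℕ.* (k ! ℕ.* (n ∸ k) !) ≡⟨ ℕ.m/n*n≡m (ℕC.k![n∸k]!∣n! k≤n) ⟩
  n !                                                ∎
  where instance _ = ℕ.m*n≢0 (k !) ((n ∸ k) !) {{k ℕ.!≢0}} {{(n ∸ k) ℕ.!≢0}}

invFact-binomial : ∀ {n k} → k ≤ n → invFact k * invFact (n ∸ k) ≡ ℕ→ℚ (n C k) * invFact n
invFact-binomial {n} {k} k≤n = *-inverse-unique {q = ℕ→ℚ (k ! ℕ.* (n ∸ k) !)}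
  (begin
    invFact k * invFact (n ∸ k) * ℕ→ℚ (k ! ℕ.* (n ∸ k) !)
      ≡⟨ cong (invFact k * invFact (n ∸ k) *_) (ℕ→ℚ-* (k !) ((n ∸ k) !)) ⟩
    invFact k * invFact (n ∸ k) * (ℕ→ℚ (k !) * ℕ→ℚ ((n ∸ k) !))
      ≡⟨ solve 4 (λ a b c d → a :* b :* (c :* d) := (a :* c) :* (b :* d)) refl (invFact k) (invFact (n ∸ k)) _ _ ⟩
    (invFact k * ℕ→ℚ (k !)) * (invFact (n ∸ k) * ℕ→ℚ ((n ∸ k) !))
      ≡⟨ cong₂ _*_ (invFact-*-! k) (invFact-*-! (n ∸ k)) ⟩
    1ℚ ∎)
  (begin
    ℕ→ℚ (k ! ℕ.* (n ∸ k) !) * (ℕ→ℚ (n C k) * invFact n)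
      ≡⟨ solve 3 (λ a b c → a :* (b :* c) := (b :* a) :* c) refl (ℕ→ℚ (k ! ℕ.* (n ∸ k) !)) (ℕ→ℚ (n C k)) (invFact n) ⟩
    ℕ→ℚ (n C k) * ℕ→ℚ (k ! ℕ.* (n ∸ k) !) * invFact n
      ≡⟨ cong (_* invFact n) (ℕ→ℚ-* (n C k) _) ⟨
    ℕ→ℚ ((n C k) ℕ.* (k ! ℕ.* (n ∸ k) !)) * invFact n
      ≡⟨ cong (λ m → ℕ→ℚ m * invFact n) (nCk*k!*[n∸k]!≡n! k≤n) ⟩
    ℕ→ℚ (n !) * invFact n
      ≡⟨ !-*-invFact n ⟩
    1ℚ ∎)
  where open ℚ-Solver

^ℚ-+ : ∀ p m n → p ^ℚ (m ℕ.+ n) ≡ p ^ℚ m * p ^ℚ n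
^ℚ-+ p zero n = sym (ℚ.*-identityˡ (p ^ℚ n))
^ℚ-+ p (suc m) n = trans (cong (p *_) (^ℚ-+ p m n)) (sym (ℚ.*-assoc p (p ^ℚ m) (p ^ℚ n)))

ℕ→ℚ-^ : ∀ m n → ℕ→ℚ m ^ℚ n ≡ ℕ→ℚ (m ℕ.^ n)
ℕ→ℚ-^ m zero = refl
ℕ→ℚ-^ m (suc n) = trans (cong (ℕ→ℚ m *_) (ℕ→ℚ-^ m n)) (sym (ℕ→ℚ-* m (m ℕ.^ n)))

∑< : ℕ → (ℕ → ℚ) → ℚ
∑< zero f = 0ℚ
∑< (suc n) f = f 0 + ∑< n (f ∘ suc)

∑<-cong : ∀ n {f g : ℕ → ℚ} → (∀ k → k < n → f k ≡ g k) → ∑< n f ≡ ∑< n g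
∑<-cong zero eq = refl
∑<-cong (suc n) eq = cong₂ _+_ (eq 0 (s≤s z≤n)) (∑<-cong n (λ k k<n → eq (suc k) (s≤s k<n)))

∑<-zero : ∀ n {f : ℕ → ℚ} → (∀ k → k < n → f k ≡ 0ℚ) → ∑< n f ≡ 0ℚ
∑<-zero zero eq = refl
∑<-zero (suc n) eq = cong₂ _+_ (eq 0 (s≤s z≤n)) (∑<-zero n (λ k k<n → eq (suc k) (s≤s k<n)))

∑<-+ : ∀ n (f g : ℕ → ℚ) → ∑< n (λ k → f k + g k) ≡ ∑< n f + ∑< n g
∑<-+ zero f g = refl
∑<-+ (suc n) f g = begin
  (f 0 + g 0) + ∑< n (λ k → f (suc k) + g (suc k))
    ≡⟨ cong ((f 0 + g 0) +_) (∑<-+ n (f ∘ suc) (g ∘ suc)) ⟩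
  (f 0 + g 0) + (∑< n (f ∘ suc) + ∑< n (g ∘ suc))
    ≡⟨ solve 4 (λ a b c d → (a :+ b) :+ (c :+ d) := (a :+ c) :+ (b :+ d)) refl (f 0) (g 0) _ _ ⟩
  (f 0 + ∑< n (f ∘ suc)) + (g 0 + ∑< n (g ∘ suc)) ∎
  where open ℚ-Solver

∑<-*ˡ : ∀ n p (f : ℕ → ℚ) → ∑< n (λ k → p * f k) ≡ p * ∑< n f
∑<-*ˡ zero p f = sym (ℚ.*-zeroʳ p)
∑<-*ˡ (suc n) p f = trans (cong (p * f 0 +_) (∑<-*ˡ n p (f ∘ suc))) (sym (ℚ.*-distribˡ-+ p (f 0) _))

∑<-suc : ∀ n (f : ℕ → ℚ) → ∑< (suc n) f ≡ ∑< n f + f n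
∑<-suc zero f = trans (ℚ.+-identityʳ (f 0)) (sym (ℚ.+-identityˡ (f 0)))
∑<-suc (suc n) f = trans (cong (f 0 +_) (∑<-suc n (f ∘ suc))) (sym (ℚ.+-assoc (f 0) _ _))

∑<-split : ∀ m n (f : ℕ → ℚ) → ∑< (m ℕ.+ n) f ≡ ∑< m f + ∑< n (λ k → f (m ℕ.+ k))
∑<-split zero n f = sym (ℚ.+-identityˡ (∑< n f))
∑<-split (suc m) n f = trans (cong (f 0 +_) (∑<-split m n (f ∘ suc))) (sym (ℚ.+-assoc (f 0) _ _))

∑<-extend : ∀ {m n} (f : ℕ → ℚ) → m ≤ n → (∀ k → m ≤ k → f k ≡ 0ℚ) → ∑< n f ≡ ∑< m f
∑<-extend {m} {n} f m≤n vanish = begin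
  ∑< n f
    ≡⟨ cong (λ l → ∑< l f) (ℕ.m+[n∸m]≡n m≤n) ⟨
  ∑< (m ℕ.+ (n ∸ m)) f
    ≡⟨ ∑<-split m (n ∸ m) f ⟩
  ∑< m f + ∑< (n ∸ m) (λ k → f (m ℕ.+ k))
    ≡⟨ cong (∑< m f +_) (∑<-zero (n ∸ m) (λ k _ → vanish (m ℕ.+ k) (ℕ.m≤m+n m k))) ⟩
  ∑< m f + 0ℚ
    ≡⟨ ℚ.+-identityʳ (∑< m f) ⟩
  ∑< m f ∎

∑<-pairs : ∀ n (f : ℕ → ℚ) → ∑< (2 ℕ.* n) f ≡ ∑< n (λ i → f (2 ℕ.* i) + f (suc (2 ℕ.* i)))
∑<-pairs zero f = refl
∑<-pairs (suc n) f = begin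
  ∑< (2 ℕ.* suc n) f
    ≡⟨ cong (λ l → ∑< l f) (ℕ.*-suc 2 n) ⟩
  f 0 + (f 1 + ∑< (2 ℕ.* n) (f ∘ suc ∘ suc))
    ≡⟨ ℚ.+-assoc (f 0) (f 1) _ ⟨
  (f 0 + f 1) + ∑< (2 ℕ.* n) (f ∘ suc ∘ suc)
    ≡⟨ cong ((f 0 + f 1) +_) (∑<-pairs n (f ∘ suc ∘ suc)) ⟩
  (f 0 + f 1) + ∑< n (λ i → g (suc (suc (2 ℕ.* i))))
    ≡⟨ cong ((f 0 + f 1) +_) (∑<-cong n (λ i _ → cong g (ℕ.*-suc 2 i))) ⟨
  (f 0 + f 1) + ∑< n (λ i → g (2 ℕ.* suc i)) ∎
  where g = λ k → f k + f (suc k)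

sumℚ-map-applyUpTo : ∀ n (g : ℕ → ℕ) (f : ℕ → ℚ) → sumℚ (map f (applyUpTo g n)) ≡ ∑< n (f ∘ g)
sumℚ-map-applyUpTo zero g f = refl
sumℚ-map-applyUpTo (suc n) g f = cong (f (g 0) +_) (sumℚ-map-applyUpTo n (g ∘ suc) f)

sumℚ-zipWith-applyUpTo : ∀ n (f : ℕ → ℚ → ℚ) (g : ℕ → ℕ) (b : ℕ → ℚ) →
  sumℚ (zipWith f (applyUpTo g n) (applyUpTo b n)) ≡ ∑< n (λ k → f (g k) (b k))
sumℚ-zipWith-applyUpTo zero f g b = refl
sumℚ-zipWith-applyUpTo (suc n) f g b = cong (f (g 0) (b 0) +_) (sumℚ-zipWith-applyUpTo n f (g ∘ suc) (b ∘ suc))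

Σ⋯≡∑< : ∀ a b (f : ℕ → ℚ) → (∀ k → k < a → f k ≡ 0ℚ) → Σ[ a ⋯ b ] f ≡ ∑< (suc b) f
Σ⋯≡∑< a b f vanish with ℕ.≤-total a (suc b)
... | inj₁ a≤1+b = begin
  sumℚ (map (λ i → f (a ℕ.+ i)) (applyUpTo id (suc b ∸ a)))
    ≡⟨ sumℚ-map-applyUpTo (suc b ∸ a) id _ ⟩
  ∑< (suc b ∸ a) (λ i → f (a ℕ.+ i))
    ≡⟨ ℚ.+-identityˡ _ ⟨
  0ℚ + ∑< (suc b ∸ a) (λ i → f (a ℕ.+ i))
    ≡⟨ cong (_+ ∑< (suc b ∸ a) (λ i → f (a ℕ.+ i))) (∑<-zero a vanish) ⟨
  ∑< a f + ∑< (suc b ∸ a) (λ i → f (a ℕ.+ i))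
    ≡⟨ ∑<-split a (suc b ∸ a) f ⟨
  ∑< (a ℕ.+ (suc b ∸ a)) f
    ≡⟨ cong (λ l → ∑< l f) (ℕ.m+[n∸m]≡n a≤1+b) ⟩
  ∑< (suc b) f ∎
... | inj₂ 1+b≤a = begin
  sumℚ (map (λ i → f (a ℕ.+ i)) (applyUpTo id (suc b ∸ a)))
    ≡⟨ cong (λ l → sumℚ (map (λ i → f (a ℕ.+ i)) (applyUpTo id l))) (ℕ.m≤n⇒m∸n≡0 1+b≤a) ⟩
  0ℚ
    ≡⟨ ∑<-zero (suc b) (λ k k<1+b → vanish k (ℕ.<-≤-trans k<1+b 1+b≤a)) ⟨
  ∑< (suc b) f ∎

-- The sums defining c_{r,j}

binomialSum : ℕ → (ℕ → ℚ) → ℚ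
binomialSum zero a = a 0
binomialSum (suc m) a = binomialSum m a + binomialSum m (a ∘ suc)

binomialSum-cong : ∀ m {a b : ℕ → ℚ} → (∀ k → a k ≡ b k) → binomialSum m a ≡ binomialSum m b
binomialSum-cong zero eq = eq 0
binomialSum-cong (suc m) eq = cong₂ _+_ (binomialSum-cong m eq) (binomialSum-cong m (eq ∘ suc))

binomialSum-zero : ∀ m {a : ℕ → ℚ} → (∀ k → a k ≡ 0ℚ) → binomialSum m a ≡ 0ℚ
binomialSum-zero zero eq = eq 0
binomialSum-zero (suc m) eq = cong₂ _+_ (binomialSum-zero m eq) (binomialSum-zero m (eq ∘ suc))

binomialSum-+ : ∀ m (a b : ℕ → ℚ) → binomialSum m (λ k → a k + b k) ≡ binomialSum m a + binomialSum m b
binomialSum-+ zero a b = refl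
binomialSum-+ (suc m) a b = begin
  binomialSum m (λ k → a k + b k) + binomialSum m (λ k → a (suc k) + b (suc k))
    ≡⟨ cong₂ _+_ (binomialSum-+ m a b) (binomialSum-+ m (a ∘ suc) (b ∘ suc)) ⟩
  (binomialSum m a + binomialSum m b) + (binomialSum m (a ∘ suc) + binomialSum m (b ∘ suc))
    ≡⟨ solve 4 (λ x y z w → (x :+ y) :+ (z :+ w) := (x :+ z) :+ (y :+ w)) refl
         (binomialSum m a) (binomialSum m b) (binomialSum m (a ∘ suc)) (binomialSum m (b ∘ suc)) ⟩
  (binomialSum m a + binomialSum m (a ∘ suc)) + (binomialSum m b + binomialSum m (b ∘ suc)) ∎
  where open ℚ-Solver

binomialSum-*ˡ : ∀ m p (a : ℕ → ℚ) → binomialSum m (λ k → p * a k) ≡ p * binomialSum m a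
binomialSum-*ˡ zero p a = refl
binomialSum-*ˡ (suc m) p a =
  trans (cong₂ _+_ (binomialSum-*ˡ m p a) (binomialSum-*ˡ m p (a ∘ suc))) (sym (ℚ.*-distribˡ-+ p _ _))

∑<-binomial : ∀ m {N} (a : ℕ → ℚ) → m < N → ∑< N (λ k → ℕ→ℚ (m C k) * a k) ≡ binomialSum m a
∑<-binomial zero {suc N} a _ = begin
  1ℚ * a 0 + ∑< N (λ k → ℕ→ℚ (0 C suc k) * a (suc k))  ≡⟨ cong (1ℚ * a 0 +_) (∑<-zero N (λ k _ → ℚ.*-zeroˡ (a (suc k)))) ⟩
  1ℚ * a 0 + 0ℚ                                          ≡⟨ solve 1 (λ x → con 1ℚ :* x :+ con 0ℚ := x) refl (a 0) ⟩
  a 0                                                    ∎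
  where open ℚ-Solver
∑<-binomial (suc m) {suc N} a (s≤s m<N) = begin
  1ℚ * a 0 + ∑< N (λ k → ℕ→ℚ (suc m C suc k) * a (suc k))
    ≡⟨ cong (1ℚ * a 0 +_) (∑<-cong N (λ k _ → pascal k)) ⟩
  1ℚ * a 0 + ∑< N (λ k → ℕ→ℚ (m C k) * a (suc k) + ℕ→ℚ (m C suc k) * a (suc k))
    ≡⟨ cong (1ℚ * a 0 +_) (∑<-+ N _ _) ⟩
  1ℚ * a 0 + (∑< N (λ k → ℕ→ℚ (m C k) * a (suc k)) + ∑< N (λ k → ℕ→ℚ (m C suc k) * a (suc k)))
    ≡⟨ solve 3 (λ x y z → x :+ (y :+ z) := (x :+ z) :+ y) refl
         (1ℚ * a 0) (∑< N (λ k → ℕ→ℚ (m C k) * a (suc k))) (∑< N (λ k → ℕ→ℚ (m C suc k) * a (suc k))) ⟩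
  ∑< (suc N) (λ k → ℕ→ℚ (m C k) * a k) + ∑< N (λ k → ℕ→ℚ (m C k) * a (suc k))
    ≡⟨ cong₂ _+_ (∑<-binomial m a (ℕ.m≤n⇒m≤1+n m<N)) (∑<-binomial m (a ∘ suc) m<N) ⟩
  binomialSum (suc m) a ∎
  where
  open ℚ-Solver
  pascal : ∀ k → ℕ→ℚ (suc m C suc k) * a (suc k) ≡ ℕ→ℚ (m C k) * a (suc k) + ℕ→ℚ (m C suc k) * a (suc k)
  pascal k = begin
    ℕ→ℚ (suc m C suc k) * a (suc k)                     ≡⟨ cong (λ n → ℕ→ℚ n * a (suc k)) (ℕC.nCk+nC[k+1]≡[n+1]C[k+1] m k) ⟨
    ℕ→ℚ (m C k ℕ.+ m C suc k) * a (suc k)               ≡⟨ cong (_* a (suc k)) (ℕ→ℚ-+ (m C k) (m C suc k)) ⟩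
    (ℕ→ℚ (m C k) + ℕ→ℚ (m C suc k)) * a (suc k)         ≡⟨ ℚ.*-distribʳ-+ (a (suc k)) (ℕ→ℚ (m C k)) (ℕ→ℚ (m C suc k)) ⟩
    ℕ→ℚ (m C k) * a (suc k) + ℕ→ℚ (m C suc k) * a (suc k) ∎

binomialSum-suc-suc : ∀ m a →
  binomialSum (suc (suc m)) a ≡ binomialSum m a + binomialSum m (λ k → ℕ→ℚ 2 * a (suc k) + a (suc (suc k)))
binomialSum-suc-suc m a = begin
  (binomialSum m a + binomialSum m (a ∘ suc)) + (binomialSum m (a ∘ suc) + binomialSum m (a ∘ suc ∘ suc))
    ≡⟨ solve 3 (λ x y z → (x :+ y) :+ (y :+ z) := x :+ (con (ℕ→ℚ 2) :* y :+ z)) refl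
         (binomialSum m a) (binomialSum m (a ∘ suc)) (binomialSum m (a ∘ suc ∘ suc)) ⟩
  binomialSum m a + (ℕ→ℚ 2 * binomialSum m (a ∘ suc) + binomialSum m (a ∘ suc ∘ suc))
    ≡⟨ cong (λ x → binomialSum m a + (x + binomialSum m (a ∘ suc ∘ suc))) (binomialSum-*ˡ m (ℕ→ℚ 2) (a ∘ suc)) ⟨
  binomialSum m a + (binomialSum m (λ k → ℕ→ℚ 2 * a (suc k)) + binomialSum m (a ∘ suc ∘ suc))
    ≡⟨ cong (binomialSum m a +_) (binomialSum-+ m _ _) ⟨
  binomialSum m a + binomialSum m (λ k → ℕ→ℚ 2 * a (suc k) + a (suc (suc k))) ∎
  where open ℚ-Solver

binomialSum-absorb : ∀ m (g : ℕ → ℚ) →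
  binomialSum (suc m) (λ k → ℕ→ℚ k * g k) ≡ ℕ→ℚ (suc m) * binomialSum m (g ∘ suc)
binomialSum-absorb zero g = solve 2 (λ x y → con 0ℚ :* x :+ con 1ℚ :* y := con 1ℚ :* y) refl (g 0) (g 1)
  where open ℚ-Solver
binomialSum-absorb (suc m) g = begin
  binomialSum (suc m) (λ k → ℕ→ℚ k * g k) + binomialSum (suc m) (λ k → ℕ→ℚ (suc k) * g (suc k))
    ≡⟨ cong (binomialSum (suc m) (λ k → ℕ→ℚ k * g k) +_)
         (trans (binomialSum-cong (suc m) split) (binomialSum-+ (suc m) (g ∘ suc) (λ k → ℕ→ℚ k * g (suc k)))) ⟩
  binomialSum (suc m) (λ k → ℕ→ℚ k * g k) + (binomialSum (suc m) (g ∘ suc) + binomialSum (suc m) (λ k → ℕ→ℚ k * g (suc k)))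
    ≡⟨ cong₂ (λ x y → x + (binomialSum (suc m) (g ∘ suc) + y)) (binomialSum-absorb m g) (binomialSum-absorb m (g ∘ suc)) ⟩
  M * A + ((A + A′) + M * A′)
    ≡⟨ solve 3 (λ M x y → M :* x :+ ((x :+ y) :+ M :* y) := (con 1ℚ :+ M) :* (x :+ y)) refl M A A′ ⟩
  (1ℚ + M) * (A + A′)
    ≡⟨ cong (_* (A + A′)) (ℕ→ℚ-suc (suc m)) ⟨
  ℕ→ℚ (suc (suc m)) * binomialSum (suc m) (g ∘ suc) ∎
  where
  open ℚ-Solver
  M = ℕ→ℚ (suc m)
  A = binomialSum m (g ∘ suc)
  A′ = binomialSum m (g ∘ suc ∘ suc)
  split : ∀ k → ℕ→ℚ (suc k) * g (suc k) ≡ g (suc k) + ℕ→ℚ k * g (suc k)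
  split k = trans (cong (_* g (suc k)) (ℕ→ℚ-suc k))
                  (solve 2 (λ n x → (con 1ℚ :+ n) :* x := x :+ n :* x) refl (ℕ→ℚ k) (g (suc k)))

k<j⇒S≡0 : ∀ {k j} → k < j → S k j ≡ 0
k<j⇒S≡0 {zero} {suc j} _ = refl
k<j⇒S≡0 {suc k} {suc j} (s≤s k<j) =
  trans (cong₂ (λ x y → k ℕ.* x ℕ.+ y) (k<j⇒S≡0 (ℕ.m<n⇒m<1+n k<j)) (k<j⇒S≡0 k<j))
        (cong (ℕ._+ 0) (ℕ.*-zeroʳ k))

cSum : ℕ → ℕ → ℚ
cSum r j = Σ[ j ⋯ r ] (λ k → ((- ℕ→ℚ 2) ^ℚ (k ∸ j)) * invFact (k ∸ 1) * ℕ→ℚ (r C k) * ℕ→ℚ (S k j))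

cTerm : ℕ → ℕ → ℚ
cTerm j k = ((- ℕ→ℚ 2) ^ℚ (k ∸ j)) * invFact (k ∸ 1) * ℕ→ℚ (S k j)

stirlingTerm : ℕ → ℕ → ℚ
stirlingTerm j k = ((- ℕ→ℚ 2) ^ℚ (k ∸ j)) * invFact k * ℕ→ℚ (S k j)

cSum≡binomialSum : ∀ r j → cSum r j ≡ binomialSum r (cTerm j)
cSum≡binomialSum r j = begin
  cSum r j
    ≡⟨ Σ⋯≡∑< j r summand (λ k k<j → trans (cong (λ s → prefix k * ℕ→ℚ s) (k<j⇒S≡0 k<j)) (ℚ.*-zeroʳ (prefix k))) ⟩
  ∑< (suc r) summand
    ≡⟨ ∑<-cong (suc r) (λ k _ → reorder (ℕ→ℚ (r C k)) k) ⟩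
  ∑< (suc r) (λ k → ℕ→ℚ (r C k) * cTerm j k) ≡⟨ ∑<-binomial r (cTerm j) ℕ.≤-refl ⟩
  binomialSum r (cTerm j) ∎
  where
  open ℚ-Solver
  prefix = λ k → ((- ℕ→ℚ 2) ^ℚ (k ∸ j)) * invFact (k ∸ 1) * ℕ→ℚ (r C k)
  summand = λ k → prefix k * ℕ→ℚ (S k j)
  reorder : ∀ x k → ((- ℕ→ℚ 2) ^ℚ (k ∸ j)) * invFact (k ∸ 1) * x * ℕ→ℚ (S k j) ≡ x * cTerm j k
  reorder x k = solve 4 (λ a b x s → a :* b :* x :* s := x :* (a :* b :* s))
                        refl ((- ℕ→ℚ 2) ^ℚ (k ∸ j)) (invFact (k ∸ 1)) x (ℕ→ℚ (S k j))

cTerm≡k*stirlingTerm : ∀ j k → cTerm (suc j) k ≡ ℕ→ℚ k * stirlingTerm (suc j) k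
cTerm≡k*stirlingTerm j zero = trans (ℚ.*-zeroʳ (((- ℕ→ℚ 2) ^ℚ 0) * invFact 0)) (sym (ℚ.*-zeroˡ (stirlingTerm (suc j) 0)))
cTerm≡k*stirlingTerm j (suc k) = begin
  p * invFact k * s
    ≡⟨ cong (λ f → p * f * s) (invFact-suc k) ⟨
  p * (invFact (suc k) * ℕ→ℚ (suc k)) * s
    ≡⟨ solve 4 (λ p f n s → p :* (f :* n) :* s := n :* (p :* f :* s)) refl p (invFact (suc k)) (ℕ→ℚ (suc k)) s ⟩
  ℕ→ℚ (suc k) * (p * invFact (suc k) * s) ∎
  where
  open ℚ-Solver
  p = (- ℕ→ℚ 2) ^ℚ (suc k ∸ suc j)
  s = ℕ→ℚ (S (suc k) (suc j))

cTerm-stirling : ∀ j k → ℕ→ℚ 2 * cTerm (suc j) (suc k) + cTerm (suc j) (suc (suc k)) ≡ stirlingTerm j (suc k)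
cTerm-stirling j k with j ℕ.≤? k
... | yes j≤k = begin
  ℕ→ℚ 2 * (p * invFact k * ℕ→ℚ s₁) + (- ℕ→ℚ 2) ^ℚ (suc k ∸ j) * f * ℕ→ℚ (suc k ℕ.* s₁ ℕ.+ s₀)
    ≡⟨ cong₂ (λ x y → ℕ→ℚ 2 * (p * x * ℕ→ℚ s₁) + (- ℕ→ℚ 2) ^ℚ y * f * ℕ→ℚ (suc k ℕ.* s₁ ℕ.+ s₀))
             (invFact-suc k) (sym (ℕ.+-∸-assoc 1 j≤k)) ⟨
  ℕ→ℚ 2 * (p * (f * ℕ→ℚ (suc k)) * ℕ→ℚ s₁) + (- ℕ→ℚ 2) * p * f * ℕ→ℚ (suc k ℕ.* s₁ ℕ.+ s₀)
    ≡⟨ cong (λ x → ℕ→ℚ 2 * (p * (f * ℕ→ℚ (suc k)) * ℕ→ℚ s₁) + (- ℕ→ℚ 2) * p * f * x)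
            (trans (ℕ→ℚ-+ (suc k ℕ.* s₁) s₀) (cong (_+ ℕ→ℚ s₀) (ℕ→ℚ-* (suc k) s₁))) ⟩
  ℕ→ℚ 2 * (p * (f * ℕ→ℚ (suc k)) * ℕ→ℚ s₁) + (- ℕ→ℚ 2) * p * f * (ℕ→ℚ (suc k) * ℕ→ℚ s₁ + ℕ→ℚ s₀)
    ≡⟨ solve 6 (λ t p f n x y → t :* (p :* (f :* n) :* x) :+ (:- t) :* p :* f :* (n :* x :+ y) := (:- t) :* p :* f :* y)
             refl (ℕ→ℚ 2) p f (ℕ→ℚ (suc k)) (ℕ→ℚ s₁) (ℕ→ℚ s₀) ⟩
  (- ℕ→ℚ 2) * p * f * ℕ→ℚ s₀
    ≡⟨ cong (λ y → (- ℕ→ℚ 2) ^ℚ y * f * ℕ→ℚ s₀) (ℕ.+-∸-assoc 1 j≤k) ⟨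
  stirlingTerm j (suc k) ∎
  where
  open ℚ-Solver
  p = (- ℕ→ℚ 2) ^ℚ (k ∸ j)
  f = invFact (suc k)
  s₁ = S (suc k) (suc j)
  s₀ = S (suc k) j
... | no j≰k = begin
  ℕ→ℚ 2 * (p * invFact k * ℕ→ℚ s₁) + q * ℕ→ℚ (suc k ℕ.* s₁ ℕ.+ s₀)
    ≡⟨ cong (λ s → ℕ→ℚ 2 * (p * invFact k * ℕ→ℚ s) + q * ℕ→ℚ (suc k ℕ.* s ℕ.+ s₀)) s₁≡0 ⟩
  ℕ→ℚ 2 * (p * invFact k * 0ℚ) + q * ℕ→ℚ (suc k ℕ.* 0 ℕ.+ s₀)
    ≡⟨ cong (λ n → ℕ→ℚ 2 * (p * invFact k * 0ℚ) + q * ℕ→ℚ (n ℕ.+ s₀)) (ℕ.*-zeroʳ (suc k)) ⟩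
  ℕ→ℚ 2 * (p * invFact k * 0ℚ) + q * ℕ→ℚ s₀
    ≡⟨ solve 4 (λ t p f x → t :* (p :* f :* con 0ℚ) :+ x := x) refl (ℕ→ℚ 2) p (invFact k) (q * ℕ→ℚ s₀) ⟩
  stirlingTerm j (suc k) ∎
  where
  open ℚ-Solver
  p = (- ℕ→ℚ 2) ^ℚ (k ∸ j)
  q = (- ℕ→ℚ 2) ^ℚ (suc k ∸ j) * invFact (suc k)
  s₁ = S (suc k) (suc j)
  s₀ = S (suc k) j
  s₁≡0 : s₁ ≡ 0
  s₁≡0 = k<j⇒S≡0 (s≤s (ℕ.≰⇒> j≰k))

cSum-suc-suc : ∀ m j → cSum (suc (suc m)) (suc j) ≡ cSum m (suc j) + binomialSum m (stirlingTerm j ∘ suc)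
cSum-suc-suc m j = begin
  cSum (suc (suc m)) (suc j)                      ≡⟨ cSum≡binomialSum (suc (suc m)) (suc j) ⟩
  binomialSum (suc (suc m)) (cTerm (suc j))       ≡⟨ binomialSum-suc-suc m (cTerm (suc j)) ⟩
  binomialSum m (cTerm (suc j)) + binomialSum m (λ k → ℕ→ℚ 2 * cTerm (suc j) (suc k) + cTerm (suc j) (suc (suc k)))
    ≡⟨ cong₂ _+_ (sym (cSum≡binomialSum m (suc j))) (binomialSum-cong m (cTerm-stirling j)) ⟩
  cSum m (suc j) + binomialSum m (stirlingTerm j ∘ suc) ∎

cSum-recurrence : ∀ m j →
  ℕ→ℚ (suc m) * cSum (suc (suc m)) (suc (suc j)) ≡ ℕ→ℚ (suc m) * cSum m (suc (suc j)) + cSum (suc m) (suc j)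
cSum-recurrence m j = begin
  M * cSum (suc (suc m)) (suc (suc j))                              ≡⟨ cong (M *_) (cSum-suc-suc m (suc j)) ⟩
  M * (cSum m (suc (suc j)) + binomialSum m (stirlingTerm (suc j) ∘ suc))
    ≡⟨ ℚ.*-distribˡ-+ M (cSum m (suc (suc j))) _ ⟩
  M * cSum m (suc (suc j)) + M * binomialSum m (stirlingTerm (suc j) ∘ suc)
    ≡⟨ cong (M * cSum m (suc (suc j)) +_) (binomialSum-absorb m (stirlingTerm (suc j))) ⟨
  M * cSum m (suc (suc j)) + binomialSum (suc m) (λ k → ℕ→ℚ k * stirlingTerm (suc j) k)
    ≡⟨ cong (M * cSum m (suc (suc j)) +_) (binomialSum-cong (suc m) (cTerm≡k*stirlingTerm j)) ⟨
  M * cSum m (suc (suc j)) + binomialSum (suc m) (cTerm (suc j))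
    ≡⟨ cong (M * cSum m (suc (suc j)) +_) (cSum≡binomialSum (suc m) (suc j)) ⟨
  M * cSum m (suc (suc j)) + cSum (suc m) (suc j) ∎
  where M = ℕ→ℚ (suc m)

cSum-recurrence₁ : ∀ m → cSum (suc (suc m)) 1 ≡ cSum m 1
cSum-recurrence₁ m = begin
  cSum (suc (suc m)) 1
    ≡⟨ cSum-suc-suc m 0 ⟩
  cSum m 1 + binomialSum m (stirlingTerm 0 ∘ suc)
    ≡⟨ cong (cSum m 1 +_) (binomialSum-zero m (λ k → ℚ.*-zeroʳ (((- ℕ→ℚ 2) ^ℚ suc k) * invFact (suc k)))) ⟩
  cSum m 1 + 0ℚ
    ≡⟨ ℚ.+-identityʳ (cSum m 1) ⟩
  cSum m 1 ∎

-- Formal power series over ℚ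

Series : Set
Series = ℕ → ℚ

infixl 6 _⊕_ _⊝_
infixl 7 _⊛_

_⊕_ : Series → Series → Series
(f ⊕ g) n = f n + g n

⊖_ : Series → Series
(⊖ f) n = - f n

_⊝_ : Series → Series → Series
f ⊝ g = f ⊕ ⊖ g

𝟘 : Series
𝟘 _ = 0ℚ

const : ℚ → Series
const p zero = p
const p (suc _) = 0ℚ

𝟙 : Series
𝟙 = const 1ℚ

_⊛_ : Series → Series → Series
(f ⊛ g) zero = f 0 * g 0
(f ⊛ g) (suc n) = f 0 * g (suc n) + ((f ∘ suc) ⊛ g) n

⊛-cong : ∀ {f f′ g g′} → f ≗ f′ → g ≗ g′ → f ⊛ g ≗ f′ ⊛ g′
⊛-cong f≗f′ g≗g′ zero = cong₂ _*_ (f≗f′ 0) (g≗g′ 0)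
⊛-cong f≗f′ g≗g′ (suc n) = cong₂ _+_ (cong₂ _*_ (f≗f′ 0) (g≗g′ (suc n))) (⊛-cong (f≗f′ ∘ suc) g≗g′ n)

⊛-zeroˡ : ∀ f → 𝟘 ⊛ f ≗ 𝟘
⊛-zeroˡ f zero = ℚ.*-zeroˡ (f 0)
⊛-zeroˡ f (suc n) = trans (cong₂ _+_ (ℚ.*-zeroˡ (f (suc n))) (⊛-zeroˡ f n)) (ℚ.+-identityˡ 0ℚ)

const-⊛ : ∀ p f → const p ⊛ f ≗ λ n → p * f n
const-⊛ p f zero = refl
const-⊛ p f (suc n) = trans (cong (p * f (suc n) +_) (⊛-zeroˡ f n)) (ℚ.+-identityʳ (p * f (suc n)))

⊛-identityˡ : ∀ f → 𝟙 ⊛ f ≗ f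
⊛-identityˡ f n = trans (const-⊛ 1ℚ f n) (ℚ.*-identityˡ (f n))

⊛-distribʳ : ∀ f g h → (f ⊕ g) ⊛ h ≗ f ⊛ h ⊕ g ⊛ h
⊛-distribʳ f g h zero = ℚ.*-distribʳ-+ (h 0) (f 0) (g 0)
⊛-distribʳ f g h (suc n) = begin
  (f 0 + g 0) * h (suc n) + ((f ∘ suc ⊕ g ∘ suc) ⊛ h) n
    ≡⟨ cong ((f 0 + g 0) * h (suc n) +_) (⊛-distribʳ (f ∘ suc) (g ∘ suc) h n) ⟩
  (f 0 + g 0) * h (suc n) + (((f ∘ suc) ⊛ h) n + ((g ∘ suc) ⊛ h) n)
    ≡⟨ solve 5 (λ a b c x y → (a :+ b) :* c :+ (x :+ y) := (a :* c :+ x) :+ (b :* c :+ y)) refl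
             (f 0) (g 0) (h (suc n)) (((f ∘ suc) ⊛ h) n) (((g ∘ suc) ⊛ h) n) ⟩
  (f 0 * h (suc n) + ((f ∘ suc) ⊛ h) n) + (g 0 * h (suc n) + ((g ∘ suc) ⊛ h) n) ∎
  where open ℚ-Solver

⊛-distribˡ : ∀ h f g → h ⊛ (f ⊕ g) ≗ h ⊛ f ⊕ h ⊛ g
⊛-distribˡ h f g zero = ℚ.*-distribˡ-+ (h 0) (f 0) (g 0)
⊛-distribˡ h f g (suc n) = begin
  h 0 * (f (suc n) + g (suc n)) + ((h ∘ suc) ⊛ (f ⊕ g)) n
    ≡⟨ cong (h 0 * (f (suc n) + g (suc n)) +_) (⊛-distribˡ (h ∘ suc) f g n) ⟩
  h 0 * (f (suc n) + g (suc n)) + (((h ∘ suc) ⊛ f) n + ((h ∘ suc) ⊛ g) n)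
    ≡⟨ solve 5 (λ a b c x y → a :* (b :+ c) :+ (x :+ y) := (a :* b :+ x) :+ (a :* c :+ y)) refl
             (h 0) (f (suc n)) (g (suc n)) (((h ∘ suc) ⊛ f) n) (((h ∘ suc) ⊛ g) n) ⟩
  (h 0 * f (suc n) + ((h ∘ suc) ⊛ f) n) + (h 0 * g (suc n) + ((h ∘ suc) ⊛ g) n) ∎
  where open ℚ-Solver

⊛-scaleˡ : ∀ p f g → (λ k → p * f k) ⊛ g ≗ λ n → p * (f ⊛ g) n
⊛-scaleˡ p f g zero = ℚ.*-assoc p (f 0) (g 0)
⊛-scaleˡ p f g (suc n) = begin
  p * f 0 * g (suc n) + ((λ k → p * f (suc k)) ⊛ g) n
    ≡⟨ cong (p * f 0 * g (suc n) +_) (⊛-scaleˡ p (f ∘ suc) g n) ⟩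
  p * f 0 * g (suc n) + p * ((f ∘ suc) ⊛ g) n
    ≡⟨ solve 4 (λ p a b x → p :* a :* b :+ p :* x := p :* (a :* b :+ x)) refl
                                                                p (f 0) (g (suc n)) (((f ∘ suc) ⊛ g) n) ⟩
  p * (f 0 * g (suc n) + ((f ∘ suc) ⊛ g) n) ∎
  where open ℚ-Solver

⊛-assoc : ∀ f g h → (f ⊛ g) ⊛ h ≗ f ⊛ (g ⊛ h)
⊛-assoc f g h zero = ℚ.*-assoc (f 0) (g 0) (h 0)
⊛-assoc f g h (suc n) = begin
  f 0 * g 0 * h (suc n) + (((λ k → f 0 * g (suc k)) ⊕ (f ∘ suc) ⊛ g) ⊛ h) n
    ≡⟨ cong (f 0 * g 0 * h (suc n) +_) (⊛-distribʳ (λ k → f 0 * g (suc k)) ((f ∘ suc) ⊛ g) h n) ⟩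
  f 0 * g 0 * h (suc n) + (((λ k → f 0 * g (suc k)) ⊛ h) n + (((f ∘ suc) ⊛ g) ⊛ h) n)
    ≡⟨ cong₂ (λ x y → f 0 * g 0 * h (suc n) + (x + y)) (⊛-scaleˡ (f 0) (g ∘ suc) h n) (⊛-assoc (f ∘ suc) g h n) ⟩
  f 0 * g 0 * h (suc n) + (f 0 * ((g ∘ suc) ⊛ h) n + ((f ∘ suc) ⊛ (g ⊛ h)) n)
    ≡⟨ solve 5 (λ a b c x y → a :* b :* c :+ (a :* x :+ y) := a :* (b :* c :+ x) :+ y) refl
             (f 0) (g 0) (h (suc n)) (((g ∘ suc) ⊛ h) n) (((f ∘ suc) ⊛ (g ⊛ h)) n) ⟩
  f 0 * (g 0 * h (suc n) + ((g ∘ suc) ⊛ h) n) + ((f ∘ suc) ⊛ (g ⊛ h)) n ∎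
  where open ℚ-Solver

-- The step to n + 2 uses commutativity at both n + 1 and n.
⊛-comm-upTo : ∀ n → (∀ f g → (f ⊛ g) n ≡ (g ⊛ f) n) × (∀ f g → (f ⊛ g) (suc n) ≡ (g ⊛ f) (suc n))
⊛-comm-upTo zero = (λ f g → ℚ.*-comm (f 0) (g 0))
                 , (λ f g → solve 4 (λ a b c d → a :* b :+ c :* d := d :* c :+ b :* a) refl (f 0) (g 1) (f 1) (g 0))
  where open ℚ-Solver
⊛-comm-upTo (suc n) = proj₂ ih , step
  where
  open ℚ-Solver
  ih = ⊛-comm-upTo n
  step : ∀ f g → (f ⊛ g) (suc (suc n)) ≡ (g ⊛ f) (suc (suc n))
  step f g = begin
    f 0 * g (suc (suc n)) + ((f ∘ suc) ⊛ g) (suc n)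
      ≡⟨ cong (f 0 * g (suc (suc n)) +_) (proj₂ ih (f ∘ suc) g) ⟩
    f 0 * g (suc (suc n)) + (g 0 * f (suc (suc n)) + ((g ∘ suc) ⊛ (f ∘ suc)) n)
      ≡⟨ cong (λ x → f 0 * g (suc (suc n)) + (g 0 * f (suc (suc n)) + x)) (proj₁ ih (g ∘ suc) (f ∘ suc)) ⟩
    f 0 * g (suc (suc n)) + (g 0 * f (suc (suc n)) + ((f ∘ suc) ⊛ (g ∘ suc)) n)
      ≡⟨ solve 5 (λ a b c d x → a :* b :+ (c :* d :+ x) := c :* d :+ (a :* b :+ x)) refl
               (f 0) (g (suc (suc n))) (g 0) (f (suc (suc n))) (((f ∘ suc) ⊛ (g ∘ suc)) n) ⟩
    g 0 * f (suc (suc n)) + (f 0 * g (suc (suc n)) + ((f ∘ suc) ⊛ (g ∘ suc)) n)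
      ≡⟨ cong (g 0 * f (suc (suc n)) +_) (proj₂ ih (g ∘ suc) f) ⟨
    g 0 * f (suc (suc n)) + ((g ∘ suc) ⊛ f) (suc n) ∎

⊛-comm : ∀ f g → f ⊛ g ≗ g ⊛ f
⊛-comm f g n = proj₁ (⊛-comm-upTo n) f g

series-commutativeRing : CommutativeRing 0ℓ 0ℓ
series-commutativeRing = record
  { Carrier = Series ; _≈_ = _≗_ ; _+_ = _⊕_ ; _*_ = _⊛_ ; -_ = ⊖_ ; 0# = 𝟘 ; 1# = 𝟙
  ; isCommutativeRing = record
    { isRing = record
      { +-isAbelianGroup = record
        { isGroup = record
          { isMonoid = record
            { isSemigroup = record
              { isMagma = record
                { isEquivalence = Setoid.isEquivalence (ℕ →-setoid ℚ)
                ; ∙-cong = λ f≗f′ g≗g′ n → cong₂ _+_ (f≗f′ n) (g≗g′ n) }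
              ; assoc = λ f g h n → ℚ.+-assoc (f n) (g n) (h n) }
            ; identity = (λ f n → ℚ.+-identityˡ (f n)) , (λ f n → ℚ.+-identityʳ (f n)) }
          ; inverse = (λ f n → ℚ.+-inverseˡ (f n)) , (λ f n → ℚ.+-inverseʳ (f n))
          ; ⁻¹-cong = λ f≗g n → cong -_ (f≗g n) }
        ; comm = λ f g n → ℚ.+-comm (f n) (g n) }
      ; *-cong = ⊛-cong
      ; *-assoc = ⊛-assoc
      ; *-identity = ⊛-identityˡ , (λ f n → trans (⊛-comm f 𝟙 n) (⊛-identityˡ f n))
      ; distrib = ⊛-distribˡ , (λ h f g → ⊛-distribʳ f g h) }
    ; *-comm = ⊛-comm } }

const-morphism : ℚ.+-*-rawRing -Raw-AlmostCommutative⟶ fromCommutativeRing series-commutativeRing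
const-morphism = record
  { ⟦_⟧ = const
  ; +-homo = λ { p q zero → refl ; p q (suc n) → sym (ℚ.+-identityˡ 0ℚ) }
  ; *-homo = λ p q n → sym (trans (const-⊛ p (const q) n) (homo p q n))
  ; -‿homo = λ { p zero → refl ; p (suc n) → refl }
  ; 0-homo = λ { zero → refl ; (suc n) → refl }
  ; 1-homo = λ _ → refl }
  where
  homo : ∀ p q n → p * const q n ≡ const (p * q) n
  homo p q zero = refl
  homo p q (suc n) = ℚ.*-zeroʳ p

const-≟ : ∀ p q → Maybe (const p ≗ const q)
const-≟ p q with p ℚ.≟ q
... | yes refl = just (λ _ → refl)
... | no _ = nothing

module ⊛-Solver = Algebra.Solver.Ring ℚ.+-*-rawRing (fromCommutativeRing series-commutativeRing) const-morphism const-≟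

⊛-coeff : ∀ f g n → (f ⊛ g) n ≡ ∑< (suc n) (λ k → f k * g (n ∸ k))
⊛-coeff f g zero = sym (ℚ.+-identityʳ (f 0 * g 0))
⊛-coeff f g (suc n) = cong (f 0 * g (suc n) +_) (⊛-coeff (f ∘ suc) g n)

⊛-vanish : ∀ f g n → (∀ m → m ≤ n → g m ≡ 0ℚ) → (f ⊛ g) n ≡ 0ℚ
⊛-vanish f g n vanish = begin
  (f ⊛ g) n
    ≡⟨ ⊛-coeff f g n ⟩
  ∑< (suc n) (λ k → f k * g (n ∸ k))
    ≡⟨ ∑<-zero (suc n) (λ k _ → trans (cong (f k *_) (vanish (n ∸ k) (ℕ.m∸n≤m n k))) (ℚ.*-zeroʳ (f k))) ⟩
  0ℚ ∎

⊛-zeroʳ : ∀ f → f ⊛ 𝟘 ≗ 𝟘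
⊛-zeroʳ f n = ⊛-vanish f 𝟘 n (λ _ _ → refl)

X : Series
X zero = 0ℚ
X (suc zero) = 1ℚ
X (suc (suc _)) = 0ℚ

X-⊛-zero : ∀ f → (X ⊛ f) 0 ≡ 0ℚ
X-⊛-zero f = ℚ.*-zeroˡ (f 0)

X-⊛-suc : ∀ f n → (X ⊛ f) (suc n) ≡ f n
X-⊛-suc f n = trans (cong (0ℚ * f (suc n) +_) (X∘suc-⊛ n)) (solve 2 (λ a b → con 0ℚ :* a :+ b := b) refl (f (suc n)) (f n))
  where
  open ℚ-Solver
  X∘suc-⊛ : ∀ n → ((X ∘ suc) ⊛ f) n ≡ f n
  X∘suc-⊛ zero = ℚ.*-identityˡ (f 0)
  X∘suc-⊛ (suc n) = ⊛-identityˡ f (suc n)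

X-⊛-cancel : ∀ {f} → X ⊛ f ≗ 𝟘 → f ≗ 𝟘
X-⊛-cancel {f} X⊛f≗𝟘 n = trans (sym (X-⊛-suc f n)) (X⊛f≗𝟘 (suc n))

infixr 8 _^ˢ_
_^ˢ_ : Series → ℕ → Series
f ^ˢ zero = 𝟙
f ^ˢ suc r = f ⊛ f ^ˢ r

X^ˢ-⊛-zero : ∀ k f → (X ^ˢ suc k ⊛ f) 0 ≡ 0ℚ
X^ˢ-⊛-zero k f = trans (⊛-assoc X (X ^ˢ k) f 0) (X-⊛-zero (X ^ˢ k ⊛ f))

X^ˢ-⊛-suc : ∀ k f n → (X ^ˢ suc k ⊛ f) (suc n) ≡ (X ^ˢ k ⊛ f) n
X^ˢ-⊛-suc k f n = trans (⊛-assoc X (X ^ˢ k) f (suc n)) (X-⊛-suc (X ^ˢ k ⊛ f) n)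

X^ˢ-⊛-+ : ∀ j k f m → (X ^ˢ (j ℕ.+ k) ⊛ f) (j ℕ.+ m) ≡ (X ^ˢ k ⊛ f) m
X^ˢ-⊛-+ zero k f m = refl
X^ˢ-⊛-+ (suc j) k f m = trans (X^ˢ-⊛-suc (j ℕ.+ k) f (j ℕ.+ m)) (X^ˢ-⊛-+ j k f m)

X^ˢ-⊛-shift : ∀ j f m → (X ^ˢ j ⊛ f) (j ℕ.+ m) ≡ f m
X^ˢ-⊛-shift zero f m = ⊛-identityˡ f m
X^ˢ-⊛-shift (suc j) f m = trans (X^ˢ-⊛-suc j f (j ℕ.+ m)) (X^ˢ-⊛-shift j f m)

X^ˢ-⊛-≤ : ∀ {k m} f → k ≤ m → (X ^ˢ k ⊛ f) m ≡ f (m ∸ k)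
X^ˢ-⊛-≤ {k} {m} f k≤m = trans (cong (X ^ˢ k ⊛ f) (sym (ℕ.m+[n∸m]≡n k≤m))) (X^ˢ-⊛-shift k f (m ∸ k))

X^ˢ-⊛-< : ∀ {k m} f → m < k → (X ^ˢ k ⊛ f) m ≡ 0ℚ
X^ˢ-⊛-< {suc k} {zero} f _ = X^ˢ-⊛-zero k f
X^ˢ-⊛-< {suc k} {suc m} f (s≤s m<k) = trans (X^ˢ-⊛-suc k f m) (X^ˢ-⊛-< f m<k)

-- The Euler operator θ = x d/dx

θ : Series → Series
θ f n = ℕ→ℚ n * f n

θ-cong : ∀ {f g} → f ≗ g → θ f ≗ θ g
θ-cong f≗g n = cong (ℕ→ℚ n *_) (f≗g n)

θ-⊝ : ∀ f g → θ (f ⊝ g) ≗ θ f ⊝ θ g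
θ-⊝ f g n = trans (ℚ.*-distribˡ-+ (ℕ→ℚ n) (f n) (- g n))
                  (cong (ℕ→ℚ n * f n +_) (sym (ℚ.neg-distribʳ-* (ℕ→ℚ n) (g n))))

θ-const-⊛ : ∀ p f → θ (const p ⊛ f) ≗ const p ⊛ θ f
θ-const-⊛ p f n = begin
  ℕ→ℚ n * (const p ⊛ f) n    ≡⟨ cong (ℕ→ℚ n *_) (const-⊛ p f n) ⟩
  ℕ→ℚ n * (p * f n)          ≡⟨ solve 3 (λ a b c → a :* (b :* c) := b :* (a :* c)) refl (ℕ→ℚ n) p (f n) ⟩
  p * (ℕ→ℚ n * f n)          ≡⟨ const-⊛ p (θ f) n ⟨
  (const p ⊛ θ f) n          ∎
  where open ℚ-Solver

θ𝟙 : θ 𝟙 ≗ 𝟘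
θ𝟙 zero = refl
θ𝟙 (suc n) = ℚ.*-zeroʳ (ℕ→ℚ (suc n))

θX : θ X ≗ X
θX zero = refl
θX (suc zero) = refl
θX (suc (suc n)) = ℚ.*-zeroʳ (ℕ→ℚ (suc (suc n)))

θ-leibniz : ∀ f g → θ (f ⊛ g) ≗ θ f ⊛ g ⊕ f ⊛ θ g
θ-leibniz f g zero = solve 2 (λ a b → con 0ℚ :* (a :* b) := con 0ℚ :* a :* b :+ a :* (con 0ℚ :* b)) refl (f 0) (g 0)
  where open ℚ-Solver
θ-leibniz f g (suc n) = begin
  ℕ→ℚ (suc n) * (f 0 * g (suc n) + P)
    ≡⟨ cong (_* (f 0 * g (suc n) + P)) (ℕ→ℚ-suc n) ⟩
  (1ℚ + N) * (f 0 * g (suc n) + P)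
    ≡⟨ solve 4 (λ N a b P → (con 1ℚ :+ N) :* (a :* b :+ P) := con 0ℚ :* a :* b :+ (P :+ N :* P) :+ a :* ((con 1ℚ :+ N) :* b))
             refl N (f 0) (g (suc n)) P ⟩
  0ℚ * f 0 * g (suc n) + (P + N * P) + f 0 * ((1ℚ + N) * g (suc n))
    ≡⟨ cong (λ x → 0ℚ * f 0 * g (suc n) + (P + x) + f 0 * ((1ℚ + N) * g (suc n))) (θ-leibniz (f ∘ suc) g n) ⟩
  0ℚ * f 0 * g (suc n) + (P + (Q + R)) + f 0 * ((1ℚ + N) * g (suc n))
    ≡⟨ solve 6 (λ a b P Q R c → a :+ (P :+ (Q :+ R)) :+ c := (a :+ (P :+ Q)) :+ (c :+ R)) refl
             (0ℚ * f 0 * g (suc n)) (f 0) P Q R (f 0 * ((1ℚ + N) * g (suc n))) ⟩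
  (0ℚ * f 0 * g (suc n) + (P + Q)) + (f 0 * ((1ℚ + N) * g (suc n)) + R)
    ≡⟨ cong₂ (λ x y → (0ℚ * f 0 * g (suc n) + x) + (f 0 * (y * g (suc n)) + R)) (sym θf∘suc-⊛) (sym (ℕ→ℚ-suc n)) ⟩
  (θ f ⊛ g) (suc n) + (f ⊛ θ g) (suc n) ∎
  where
  open ℚ-Solver
  N = ℕ→ℚ n
  P = ((f ∘ suc) ⊛ g) n
  Q = (θ (f ∘ suc) ⊛ g) n
  R = ((f ∘ suc) ⊛ θ g) n
  θf∘suc-⊛ : ((θ f ∘ suc) ⊛ g) n ≡ P + Q
  θf∘suc-⊛ = trans (⊛-cong θf∘suc≗f∘suc⊕θ[f∘suc] (λ _ → refl) n) (⊛-distribʳ (f ∘ suc) (θ (f ∘ suc)) g n)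
    where
    θf∘suc≗f∘suc⊕θ[f∘suc] : θ f ∘ suc ≗ f ∘ suc ⊕ θ (f ∘ suc)
    θf∘suc≗f∘suc⊕θ[f∘suc] k = trans (cong (_* f (suc k)) (ℕ→ℚ-suc k))
                                    (solve 2 (λ a b → (con 1ℚ :+ b) :* a := a :+ b :* a) refl (f (suc k)) (ℕ→ℚ k))

θ-^ˢ : ∀ f r → θ (f ^ˢ suc r) ≗ const (ℕ→ℚ (suc r)) ⊛ (θ f ⊛ f ^ˢ r)
θ-^ˢ f zero n = begin
  θ (f ⊛ 𝟙) n                          ≡⟨ θ-leibniz f 𝟙 n ⟩
  (θ f ⊛ 𝟙) n + (f ⊛ θ 𝟙) n            ≡⟨ cong ((θ f ⊛ 𝟙) n +_) (trans (⊛-cong (λ _ → refl) θ𝟙 n) (⊛-zeroʳ f n)) ⟩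
  (θ f ⊛ 𝟙) n + 0ℚ                     ≡⟨ ℚ.+-identityʳ _ ⟩
  (θ f ⊛ 𝟙) n                          ≡⟨ ⊛-identityˡ (θ f ⊛ 𝟙) n ⟨
  (𝟙 ⊛ (θ f ⊛ 𝟙)) n                    ∎
θ-^ˢ f (suc r) n = begin
  θ (f ⊛ F) n
    ≡⟨ θ-leibniz f F n ⟩
  (θ f ⊛ F ⊕ f ⊛ θ F) n
    ≡⟨ cong ((θ f ⊛ F) n +_) (⊛-cong (λ _ → refl) (θ-^ˢ f r) n) ⟩
  (θ f ⊛ F ⊕ f ⊛ (K ⊛ (θ f ⊛ f ^ˢ r))) n
    ≡⟨ solve 4 (λ t f G K → t :* (f :* G) :+ f :* (K :* (t :* G)) := (con 1ℚ :+ K) :* (t :* (f :* G)))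
                                                           (λ _ → refl) (θ f) f (f ^ˢ r) K n ⟩
  ((𝟙 ⊕ K) ⊛ (θ f ⊛ F)) n
    ≡⟨ ⊛-cong 1+K≗K′ (λ _ → refl) n ⟩
  (const (ℕ→ℚ (suc (suc r))) ⊛ (θ f ⊛ F)) n ∎
  where
  open ⊛-Solver
  F = f ^ˢ suc r
  K = const (ℕ→ℚ (suc r))
  1+K≗K′ : 𝟙 ⊕ K ≗ const (ℕ→ℚ (suc (suc r)))
  1+K≗K′ zero = sym (ℕ→ℚ-suc (suc r))
  1+K≗K′ (suc n) = ℚ.+-identityˡ 0ℚ

θ-X^ˢ : ∀ k → θ (X ^ˢ k) ≗ const (ℕ→ℚ k) ⊛ X ^ˢ k
θ-X^ˢ zero n = trans (θ𝟙 n) (sym (trans (const-⊛ 0ℚ 𝟙 n) (ℚ.*-zeroˡ (𝟙 n))))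
θ-X^ˢ (suc k) n = trans (θ-^ˢ X k n) (⊛-cong (λ _ → refl) (⊛-cong θX (λ _ → refl)) n)

-- Bernoulli numbers and the Riccati equation

bernRev≡applyDownFrom : ∀ n → bernRev n ≡ applyDownFrom B (suc n)
bernRev≡applyDownFrom zero = refl
bernRev≡applyDownFrom (suc n) = cong (B (suc n) ∷_) (bernRev≡applyDownFrom n)

B-suc : ∀ n → B (suc n) ≡ - ((ℤ.+ 1 / suc (suc n)) * ∑< (suc n) (λ k → ℕ→ℚ (suc (suc n) C k) * B k))
B-suc n = cong (λ s → - ((ℤ.+ 1 / suc (suc n)) * s)) (begin
  sumℚ (zipWith term (upTo (suc n)) (reverse (bernRev n)))
    ≡⟨ cong (λ bs → sumℚ (zipWith term (upTo (suc n)) (reverse bs))) (bernRev≡applyDownFrom n) ⟩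
  sumℚ (zipWith term (upTo (suc n)) (reverse (applyDownFrom B (suc n))))
    ≡⟨ cong (λ bs → sumℚ (zipWith term (upTo (suc n)) bs)) (List.reverse-applyDownFrom B (suc n)) ⟩
  sumℚ (zipWith term (upTo (suc n)) (applyUpTo B (suc n)))
    ≡⟨ sumℚ-zipWith-applyUpTo (suc n) term id B ⟩
  ∑< (suc n) (λ k → ℕ→ℚ (suc (suc n) C k) * B k) ∎)
  where
  term : ℕ → ℚ → ℚ
  term k b = ℕ→ℚ (suc (suc n) C k) * b

bernoulli-recurrence : ∀ n → ∑< (suc (suc n)) (λ k → ℕ→ℚ (suc (suc n) C k) * B k) ≡ 0ℚ
bernoulli-recurrence n = begin
  ∑< (suc (suc n)) term
    ≡⟨ ∑<-suc (suc n) term ⟩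
  Σ + ℕ→ℚ (suc (suc n) C suc n) * B (suc n)
    ≡⟨ cong (λ m → Σ + ℕ→ℚ m * B (suc n)) [n+1]Cn≡n+1 ⟩
  Σ + N * B (suc n)
    ≡⟨ cong (λ b → Σ + N * b) (B-suc n) ⟩
  Σ + N * (- (1/N * Σ))
    ≡⟨ solve 3 (λ s a b → s :+ a :* (:- (b :* s)) := s :+ (:- ((b :* a) :* s))) refl Σ N 1/N ⟩
  Σ + (- ((1/N * N) * Σ))
    ≡⟨ cong (λ x → Σ + (- (x * Σ))) (1/n*n≡1 (suc (suc n))) ⟩
  Σ + (- (1ℚ * Σ))
    ≡⟨ solve 1 (λ s → s :+ (:- (con 1ℚ :* s)) := con 0ℚ) refl Σ ⟩
  0ℚ ∎
  where
  open ℚ-Solver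
  term = λ k → ℕ→ℚ (suc (suc n) C k) * B k
  Σ = ∑< (suc n) term
  N = ℕ→ℚ (suc (suc n))
  1/N = ℤ.+ 1 / suc (suc n)
  [n+1]Cn≡n+1 : suc (suc n) C suc n ≡ suc (suc n)
  [n+1]Cn≡n+1 = begin
    suc (suc n) C suc n                  ≡⟨ ℕC.nCk≡nC[n∸k] (ℕ.n≤1+n (suc n)) ⟩
    suc (suc n) C (suc (suc n) ∸ suc n)  ≡⟨ cong (suc (suc n) C_) (ℕ.m+n∸n≡m 1 (suc n)) ⟩
    suc (suc n) C 1                      ≡⟨ ℕC.nC1≡n (suc (suc n)) ⟩
    suc (suc n)                          ∎

expm1 : Series
expm1 zero = 0ℚ
expm1 (suc n) = invFact (suc n)

β : Series
β n = B n * invFact n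

β⊛expm1≗X : β ⊛ expm1 ≗ X
β⊛expm1≗X zero = ℚ.*-zeroʳ (β 0)
β⊛expm1≗X (suc m) = begin
  (β ⊛ expm1) (suc m)
    ≡⟨ ⊛-coeff β expm1 (suc m) ⟩
  ∑< (suc (suc m)) term
    ≡⟨ ∑<-suc (suc m) term ⟩
  ∑< (suc m) term + β (suc m) * expm1 (m ∸ m)
    ≡⟨ cong (λ k → ∑< (suc m) term + β (suc m) * expm1 k) (ℕ.n∸n≡0 m) ⟩
  ∑< (suc m) term + β (suc m) * 0ℚ
    ≡⟨ cong (∑< (suc m) term +_) (ℚ.*-zeroʳ (β (suc m))) ⟩
  ∑< (suc m) term + 0ℚ
    ≡⟨ ℚ.+-identityʳ _ ⟩
  ∑< (suc m) term
    ≡⟨ ∑<-cong (suc m) binomial-term ⟩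
  ∑< (suc m) (λ k → invFact (suc m) * (ℕ→ℚ (suc m C k) * B k))
    ≡⟨ ∑<-*ˡ (suc m) (invFact (suc m)) (λ k → ℕ→ℚ (suc m C k) * B k) ⟩
  invFact (suc m) * ∑< (suc m) (λ k → ℕ→ℚ (suc m C k) * B k)
    ≡⟨ by-recurrence m ⟩
  X (suc m) ∎
  where
  open ℚ-Solver
  term = λ k → β k * expm1 (suc m ∸ k)
  binomial-term : ∀ k → k < suc m → term k ≡ invFact (suc m) * (ℕ→ℚ (suc m C k) * B k)
  binomial-term k (s≤s k≤m) = begin
    B k * invFact k * expm1 (suc m ∸ k)
      ≡⟨ cong (λ l → B k * invFact k * expm1 l) (ℕ.+-∸-assoc 1 k≤m) ⟩
    B k * invFact k * invFact (suc (m ∸ k))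
      ≡⟨ cong (λ l → B k * invFact k * invFact l) (ℕ.+-∸-assoc 1 k≤m) ⟨
    B k * invFact k * invFact (suc m ∸ k)
      ≡⟨ ℚ.*-assoc (B k) (invFact k) _ ⟩
    B k * (invFact k * invFact (suc m ∸ k))
      ≡⟨ cong (B k *_) (invFact-binomial (ℕ.m≤n⇒m≤1+n k≤m)) ⟩
    B k * (ℕ→ℚ (suc m C k) * invFact (suc m))
      ≡⟨ solve 3 (λ a b c → a :* (b :* c) := c :* (b :* a)) refl (B k) (ℕ→ℚ (suc m C k)) (invFact (suc m)) ⟩
    invFact (suc m) * (ℕ→ℚ (suc m C k) * B k) ∎
  by-recurrence : ∀ m → invFact (suc m) * ∑< (suc m) (λ k → ℕ→ℚ (suc m C k) * B k) ≡ X (suc m)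
  by-recurrence zero = refl
  by-recurrence (suc n) = trans (cong (invFact (suc (suc n)) *_) (bernoulli-recurrence n)) (ℚ.*-zeroʳ (invFact (suc (suc n))))

θ-expm1 : θ expm1 ≗ X ⊛ expm1 ⊕ X
θ-expm1 zero = refl
θ-expm1 (suc zero) = refl
θ-expm1 (suc (suc n)) = begin
  ℕ→ℚ (suc (suc n)) * invFact (suc (suc n))   ≡⟨ ℚ.*-comm (ℕ→ℚ (suc (suc n))) _ ⟩
  invFact (suc (suc n)) * ℕ→ℚ (suc (suc n))   ≡⟨ invFact-suc (suc n) ⟩
  expm1 (suc n)                               ≡⟨ X-⊛-suc expm1 (suc n) ⟨
  (X ⊛ expm1) (suc (suc n))                   ≡⟨ ℚ.+-identityʳ _ ⟨
  (X ⊛ expm1 ⊕ X) (suc (suc n))               ∎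

≗⇒⊝≗𝟘 : ∀ {f g} → f ≗ g → f ⊝ g ≗ 𝟘
≗⇒⊝≗𝟘 {f} {g} f≗g n = trans (cong (_+ - g n) (f≗g n)) (ℚ.+-inverseʳ (g n))

⊝≗𝟘⇒≗ : ∀ {f g} → f ⊝ g ≗ 𝟘 → f ≗ g
⊝≗𝟘⇒≗ {f} {g} f⊝g≗𝟘 n = x∙y⁻¹≈ε⇒x≈y (f n) (g n) (f⊝g≗𝟘 n)

⊛-≗𝟘 : ∀ f {g} → g ≗ 𝟘 → f ⊛ g ≗ 𝟘
⊛-≗𝟘 f {g} g≗𝟘 n = trans (⊛-cong (λ _ → refl) g≗𝟘 n) (⊛-zeroʳ f n)

-- For the defect D = θ β - (β - β² - x β), the product D (e^x - 1) is a combination of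
-- θ(β (e^x - 1)) - x, θ(e^x - 1) - x (e^x - 1) - x and β (e^x - 1) - x, which all vanish;
-- hence x D = β (e^x - 1) D = 0.
β-riccati : θ β ≗ β ⊝ β ⊛ β ⊝ X ⊛ β
β-riccati = ⊝≗𝟘⇒≗ (X-⊛-cancel X⊛defect≗𝟘)
  where
  defect = θ β ⊝ (β ⊝ β ⊛ β ⊝ X ⊛ β)
  leibniz-defect = θ β ⊛ expm1 ⊕ β ⊛ θ expm1 ⊝ X
  θexpm1-defect = θ expm1 ⊝ (X ⊛ expm1 ⊕ X)
  βexpm1-defect = β ⊛ expm1 ⊝ X
  leibniz-defect≗𝟘 : leibniz-defect ≗ 𝟘
  leibniz-defect≗𝟘 = ≗⇒⊝≗𝟘 (λ n → trans (sym (θ-leibniz β expm1 n)) (trans (θ-cong β⊛expm1≗X n) (θX n)))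
  defect⊛expm1≗𝟘 : defect ⊛ expm1 ≗ 𝟘
  defect⊛expm1≗𝟘 n = begin
    (defect ⊛ expm1) n
      ≡⟨ solve 5 (λ tb b e te x → (tb :- (b :- b :* b :- x :* b)) :* e
                                := (tb :* e :+ b :* te :- x) :- b :* (te :- (x :* e :+ x)) :- (b :* e :- x) :+ b :* (b :* e :- x))
               (λ _ → refl) (θ β) β expm1 (θ expm1) X n ⟩
    (leibniz-defect ⊝ β ⊛ θexpm1-defect ⊝ βexpm1-defect ⊕ β ⊛ βexpm1-defect) n
      ≡⟨ cong₂ _+_ (cong₂ _+_ (cong₂ _+_ (leibniz-defect≗𝟘 n) (cong -_ (⊛-≗𝟘 β (≗⇒⊝≗𝟘 θ-expm1) n)))
                              (cong -_ (≗⇒⊝≗𝟘 β⊛expm1≗X n)))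
                   (⊛-≗𝟘 β (≗⇒⊝≗𝟘 β⊛expm1≗X) n) ⟩
    0ℚ ∎
    where open ⊛-Solver
  X⊛defect≗𝟘 : X ⊛ defect ≗ 𝟘
  X⊛defect≗𝟘 n = begin
    (X ⊛ defect) n                ≡⟨ ⊛-cong (sym ∘ β⊛expm1≗X) (λ _ → refl) n ⟩
    ((β ⊛ expm1) ⊛ defect) n      ≡⟨ solve 3 (λ b e d → (b :* e) :* d := b :* (d :* e)) (λ _ → refl) β expm1 defect n ⟩
    (β ⊛ (defect ⊛ expm1)) n      ≡⟨ ⊛-≗𝟘 β defect⊛expm1≗𝟘 n ⟩
    0ℚ                            ∎
    where open ⊛-Solver

½ ¼ : ℚ
½ = ℤ.+ 1 / 2
¼ = ℤ.+ 1 / 4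

h : Series
h = β ⊕ const ½ ⊛ X

h-riccati : θ h ≗ h ⊝ h ⊛ h ⊕ const ¼ ⊛ (X ⊛ X)
h-riccati n = begin
  θ h n
    ≡⟨ ℚ.*-distribˡ-+ (ℕ→ℚ n) (β n) ((const ½ ⊛ X) n) ⟩
  θ β n + θ (const ½ ⊛ X) n
    ≡⟨ cong₂ _+_ (β-riccati n) (trans (θ-const-⊛ ½ X n) (⊛-cong (λ _ → refl) θX n)) ⟩
  (β ⊝ β ⊛ β ⊝ X ⊛ β ⊕ const ½ ⊛ X) n
    ≡⟨ solve 2 (λ b x → b :- b :* b :- x :* b :+ con ½ :* x
               := (b :+ con ½ :* x) :- (b :+ con ½ :* x) :* (b :+ con ½ :* x) :+ con ¼ :* (x :* x))
                                                       (λ _ → refl) β X n ⟩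
  (h ⊝ h ⊛ h ⊕ const ¼ ⊛ (X ⊛ X)) n ∎
  where open ⊛-Solver

-- Evenness of h

σ : Series → Series
σ f n = ((- 1ℚ) ^ℚ n) * f n

σ-⊛ : ∀ f g → σ (f ⊛ g) ≗ σ f ⊛ σ g
σ-⊛ f g zero = solve 2 (λ a b → con 1ℚ :* (a :* b) := (con 1ℚ :* a) :* (con 1ℚ :* b)) refl (f 0) (g 0)
  where open ℚ-Solver
σ-⊛ f g (suc n) = begin
  - 1ℚ * s * (f 0 * g (suc n) + ((f ∘ suc) ⊛ g) n)
    ≡⟨ solve 4 (λ s a b p → (:- con 1ℚ) :* s :* (a :* b :+ p) := (con 1ℚ :* a) :* ((:- con 1ℚ) :* s :* b) :+ (:- con 1ℚ) :* (s :* p))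
             refl s (f 0) (g (suc n)) (((f ∘ suc) ⊛ g) n) ⟩
  σ f 0 * σ g (suc n) + - 1ℚ * σ ((f ∘ suc) ⊛ g) n
    ≡⟨ cong (λ x → σ f 0 * σ g (suc n) + - 1ℚ * x) (σ-⊛ (f ∘ suc) g n) ⟩
  σ f 0 * σ g (suc n) + - 1ℚ * (σ (f ∘ suc) ⊛ σ g) n
    ≡⟨ cong (σ f 0 * σ g (suc n) +_) (⊛-scaleˡ (- 1ℚ) (σ (f ∘ suc)) (σ g) n) ⟨
  σ f 0 * σ g (suc n) + ((λ k → - 1ℚ * σ (f ∘ suc) k) ⊛ σ g) n
    ≡⟨ cong (σ f 0 * σ g (suc n) +_) (⊛-cong (λ k → sym (ℚ.*-assoc (- 1ℚ) ((- 1ℚ) ^ℚ k) (f (suc k)))) (λ _ → refl) n) ⟩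
  (σ f ⊛ σ g) (suc n) ∎
  where
  open ℚ-Solver
  s = (- 1ℚ) ^ℚ n

σ-const : ∀ p → σ (const p) ≗ const p
σ-const p zero = ℚ.*-identityˡ p
σ-const p (suc n) = ℚ.*-zeroʳ ((- 1ℚ) ^ℚ suc n)

σ-X : σ X ≗ ⊖ X
σ-X zero = refl
σ-X (suc zero) = refl
σ-X (suc (suc n)) = ℚ.*-zeroʳ ((- 1ℚ) ^ℚ suc (suc n))

θ-σ : ∀ f → θ (σ f) ≗ σ (θ f)
θ-σ f n = solve 3 (λ a b c → a :* (b :* c) := b :* (a :* c)) refl (ℕ→ℚ n) ((- 1ℚ) ^ℚ n) (f n)
  where open ℚ-Solver

σ-riccati : ∀ {a c} → σ c ≗ c → θ a ≗ a ⊝ a ⊛ a ⊕ c → θ (σ a) ≗ σ a ⊝ σ a ⊛ σ a ⊕ c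
σ-riccati {a} {c} σc≗c riccati n = begin
  θ (σ a) n
    ≡⟨ θ-σ a n ⟩
  s * θ a n
    ≡⟨ cong (s *_) (riccati n) ⟩
  s * (a n + - (a ⊛ a) n + c n)
    ≡⟨ solve 4 (λ s x y z → s :* (x :+ :- y :+ z) := s :* x :+ :- (s :* y) :+ s :* z) refl s (a n) ((a ⊛ a) n) (c n) ⟩
  σ a n + - σ (a ⊛ a) n + σ c n
    ≡⟨ cong₂ (λ x y → σ a n + - x + y) (σ-⊛ a a n) (σc≗c n) ⟩
  (σ a ⊝ σ a ⊛ σ a ⊕ c) n ∎
  where
  open ℚ-Solver
  s = (- 1ℚ) ^ℚ n

-- e = a - b satisfies θ e = e - (a + b) e; as a₀ = b₀ = 1, its coefficient of x^(n+1) reads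
-- (n + 2) e_(n+1) = -(terms in e_0, ..., e_n).
riccati-unique : ∀ {a b c} → θ a ≗ a ⊝ a ⊛ a ⊕ c → θ b ≗ b ⊝ b ⊛ b ⊕ c → a 0 ≡ 1ℚ → b 0 ≡ 1ℚ → a ≗ b
riccati-unique {a} {b} {c} riccati-a riccati-b a₀≡1 b₀≡1 = ⊝≗𝟘⇒≗ (<-rec (λ n → e n ≡ 0ℚ) e≡0)
  where
  e = a ⊝ b
  θe : θ e ≗ e ⊝ (a ⊕ b) ⊛ e
  θe n = begin
    θ e n
      ≡⟨ θ-⊝ a b n ⟩
    (θ a ⊝ θ b) n
      ≡⟨ cong₂ (λ x y → x + - y) (riccati-a n) (riccati-b n) ⟩
    ((a ⊝ a ⊛ a ⊕ c) ⊝ (b ⊝ b ⊛ b ⊕ c)) n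
      ≡⟨ solve 3 (λ a b c → (a :- a :* a :+ c) :- (b :- b :* b :+ c) := (a :- b) :- (a :+ b) :* (a :- b)) (λ _ → refl) a b c n ⟩
    (e ⊝ (a ⊕ b) ⊛ e) n ∎
    where open ⊛-Solver
  e≡0 : ∀ n → (∀ {m} → m < n → e m ≡ 0ℚ) → e n ≡ 0ℚ
  e≡0 zero _ = cong₂ (λ x y → x + - y) a₀≡1 b₀≡1
  e≡0 (suc n) ih = ℕ→ℚ-*-cancelˡ (suc (suc n)) (begin
    ℕ→ℚ (suc (suc n)) * x
      ≡⟨ cong (_* x) (ℕ→ℚ-suc (suc n)) ⟩
    (1ℚ + ℕ→ℚ (suc n)) * x
      ≡⟨ solve 2 (λ N x → (con 1ℚ :+ N) :* x := N :* x :+ x) refl (ℕ→ℚ (suc n)) x ⟩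
    ℕ→ℚ (suc n) * x + x
      ≡⟨ cong (_+ x) (θe (suc n)) ⟩
    x + - ((a 0 + b 0) * x + rest) + x
      ≡⟨ cong₂ (λ s r → x + - (s * x + r) + x) (cong₂ _+_ a₀≡1 b₀≡1) rest≡0 ⟩
    x + - ((1ℚ + 1ℚ) * x + 0ℚ) + x
      ≡⟨ solve 1 (λ x → x :+ :- ((con 1ℚ :+ con 1ℚ) :* x :+ con 0ℚ) :+ x := con 0ℚ) refl x ⟩
    0ℚ
      ≡⟨ ℚ.*-zeroʳ (ℕ→ℚ (suc (suc n))) ⟨
    ℕ→ℚ (suc (suc n)) * 0ℚ ∎)
    where
    open ℚ-Solver
    x = e (suc n)
    rest = (((a ⊕ b) ∘ suc) ⊛ e) n
    rest≡0 : rest ≡ 0ℚ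
    rest≡0 = ⊛-vanish ((a ⊕ b) ∘ suc) e n (λ m m≤n → ih (s≤s m≤n))

σh≗h : σ h ≗ h
σh≗h = riccati-unique (σ-riccati σ-quarter h-riccati) h-riccati refl refl
  where
  σ-quarter : σ (const ¼ ⊛ (X ⊛ X)) ≗ const ¼ ⊛ (X ⊛ X)
  σ-quarter n = begin
    σ (const ¼ ⊛ (X ⊛ X)) n
      ≡⟨ σ-⊛ (const ¼) (X ⊛ X) n ⟩
    (σ (const ¼) ⊛ σ (X ⊛ X)) n
      ≡⟨ ⊛-cong (σ-const ¼) (λ m → trans (σ-⊛ X X m) (⊛-cong σ-X σ-X m)) n ⟩
    (const ¼ ⊛ (⊖ X ⊛ ⊖ X)) n
      ≡⟨ solve 2 (λ q x → q :* ((:- x) :* (:- x)) := q :* (x :* x)) (λ _ → refl) (const ¼) X n ⟩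
    (const ¼ ⊛ (X ⊛ X)) n ∎
    where open ⊛-Solver

[-1]^[2*i]≡1 : ∀ i → (- 1ℚ) ^ℚ (2 ℕ.* i) ≡ 1ℚ
[-1]^[2*i]≡1 zero = refl
[-1]^[2*i]≡1 (suc i) = begin
  (- 1ℚ) ^ℚ (2 ℕ.* suc i)
    ≡⟨ cong ((- 1ℚ) ^ℚ_) (ℕ.*-suc 2 i) ⟩
  - 1ℚ * (- 1ℚ * (- 1ℚ) ^ℚ (2 ℕ.* i))
    ≡⟨ solve 1 (λ s → (:- con 1ℚ) :* ((:- con 1ℚ) :* s) := s) refl ((- 1ℚ) ^ℚ (2 ℕ.* i)) ⟩
  (- 1ℚ) ^ℚ (2 ℕ.* i)
    ≡⟨ [-1]^[2*i]≡1 i ⟩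
  1ℚ ∎
  where open ℚ-Solver

h-odd≡0 : ∀ i → h (suc (2 ℕ.* i)) ≡ 0ℚ
h-odd≡0 i = ℕ→ℚ-*-cancelˡ 2 (begin
  ℕ→ℚ 2 * y
    ≡⟨ solve 1 (λ y → con (ℕ→ℚ 2) :* y := y :+ :- ((:- con 1ℚ) :* con 1ℚ :* y)) refl y ⟩
  y + - (- 1ℚ * 1ℚ * y)
    ≡⟨ cong (λ s → y + - (- 1ℚ * s * y)) ([-1]^[2*i]≡1 i) ⟨
  y + - σ h (suc (2 ℕ.* i))
    ≡⟨ cong (λ z → y + - z) (σh≗h (suc (2 ℕ.* i))) ⟩
  y + - y
    ≡⟨ ℚ.+-inverseʳ y ⟩
  0ℚ
    ≡⟨ ℚ.*-zeroʳ (ℕ→ℚ 2) ⟨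
  ℕ→ℚ 2 * 0ℚ ∎)
  where
  open ℚ-Solver
  y = h (suc (2 ℕ.* i))

-- d_{r,j} as a coefficient of h^r

module _ {A : Set} where

  sumℚ-map-cong : ∀ {f g : A → ℚ} → (∀ x → f x ≡ g x) → ∀ xs → sumℚ (map f xs) ≡ sumℚ (map g xs)
  sumℚ-map-cong f≗g xs = cong sumℚ (List.map-cong f≗g xs)

  sumℚ-map-*ˡ : ∀ p (f : A → ℚ) xs → sumℚ (map (λ x → p * f x) xs) ≡ p * sumℚ (map f xs)
  sumℚ-map-*ˡ p f [] = sym (ℚ.*-zeroʳ p)
  sumℚ-map-*ˡ p f (x ∷ xs) = trans (cong (p * f x +_) (sumℚ-map-*ˡ p f xs)) (sym (ℚ.*-distribˡ-+ p (f x) _))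

  sumℚ-map-filter : ∀ {P : A → Set} (P? : Decidable P) (f : A → ℚ) xs →
    sumℚ (map f (filter P? xs)) ≡ sumℚ (map (λ x → if does (P? x) then f x else 0ℚ) xs)
  sumℚ-map-filter P? f [] = refl
  sumℚ-map-filter P? f (x ∷ xs) with does (P? x)
  ... | true = cong (f x +_) (sumℚ-map-filter P? f xs)
  ... | false = trans (sumℚ-map-filter P? f xs) (sym (ℚ.+-identityˡ _))

  sumℚ-++ : ∀ xs ys → sumℚ (xs ++ ys) ≡ sumℚ xs + sumℚ ys
  sumℚ-++ [] ys = sym (ℚ.+-identityˡ (sumℚ ys))
  sumℚ-++ (x ∷ xs) ys = trans (cong (x +_) (sumℚ-++ xs ys)) (sym (ℚ.+-assoc x (sumℚ xs) (sumℚ ys)))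

  sumℚ-map-concatMap : ∀ {B : Set} (f : B → ℚ) (g : A → List B) xs →
    sumℚ (map f (concatMap g xs)) ≡ sumℚ (map (λ x → sumℚ (map f (g x))) xs)
  sumℚ-map-concatMap f g [] = refl
  sumℚ-map-concatMap f g (x ∷ xs) = begin
    sumℚ (map f (g x ++ concatMap g xs))                  ≡⟨ cong sumℚ (List.map-++ f (g x) (concatMap g xs)) ⟩
    sumℚ (map f (g x) ++ map f (concatMap g xs))          ≡⟨ sumℚ-++ (map f (g x)) _ ⟩
    sumℚ (map f (g x)) + sumℚ (map f (concatMap g xs))    ≡⟨ cong (sumℚ (map f (g x)) +_) (sumℚ-map-concatMap f g xs) ⟩
    sumℚ (map f (g x)) + sumℚ (map (λ x → sumℚ (map f (g x))) xs) ∎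

if-*ʳ : ∀ b p x → (if b then p * x else 0ℚ) ≡ p * (if b then x else 0ℚ)
if-*ʳ true p x = refl
if-*ʳ false p x = sym (ℚ.*-zeroʳ p)

-- By definition, d r j = evenBoxSum (λ i → B (2 i) * invFact (2 i)) r r j r.
evenBoxSum : (ℕ → ℚ) → ℕ → ℕ → ℕ → ℕ → ℚ
evenBoxSum w n b j r = sumℚ (map (λ v → vprodℚ (Vec.map w v)) (filter (λ v → j ℕ.+ 2 ℕ.* vsum v ℕ.≟ r) (box n b)))

evenBoxSum-zero : ∀ w b j r → evenBoxSum w 0 b j r ≡ (X ^ˢ j ⊛ 𝟙) r
evenBoxSum-zero w b j r = begin
  evenBoxSum w 0 b j r
    ≡⟨ sumℚ-map-filter (λ v → j ℕ.+ 2 ℕ.* vsum v ℕ.≟ r) (λ v → vprodℚ (Vec.map w v)) (Vec.[] ∷ []) ⟩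
  (if does (j ℕ.+ 0 ℕ.≟ r) then 1ℚ else 0ℚ) + 0ℚ
    ≡⟨ ℚ.+-identityʳ _ ⟩
  (if does (j ℕ.+ 0 ℕ.≟ r) then 1ℚ else 0ℚ)
    ≡⟨ cong (λ m → if does (m ℕ.≟ r) then 1ℚ else 0ℚ) (ℕ.+-identityʳ j) ⟩
  (if does (j ℕ.≟ r) then 1ℚ else 0ℚ)
    ≡⟨ X^ˢ-⊛-𝟙 j r ⟨
  (X ^ˢ j ⊛ 𝟙) r ∎
  where
  X^ˢ-⊛-𝟙 : ∀ j r → (X ^ˢ j ⊛ 𝟙) r ≡ (if does (j ℕ.≟ r) then 1ℚ else 0ℚ)
  X^ˢ-⊛-𝟙 zero zero = refl
  X^ˢ-⊛-𝟙 zero (suc r) = ⊛-identityˡ 𝟙 (suc r)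
  X^ˢ-⊛-𝟙 (suc j) zero = X^ˢ-⊛-zero j 𝟙
  X^ˢ-⊛-𝟙 (suc j) (suc r) = trans (X^ˢ-⊛-suc j 𝟙 r) (X^ˢ-⊛-𝟙 j r)

evenBoxSum-suc : ∀ w n b j r → evenBoxSum w (suc n) b j r ≡ ∑< (suc b) (λ i → w i * evenBoxSum w n b (j ℕ.+ 2 ℕ.* i) r)
evenBoxSum-suc w n b j r = begin
  sumℚ (map W (filter P? (concatMap prepend (upTo (suc b)))))
    ≡⟨ sumℚ-map-filter P? W (concatMap prepend (upTo (suc b))) ⟩
  sumℚ (map W? (concatMap prepend (upTo (suc b))))
    ≡⟨ sumℚ-map-concatMap W? prepend (upTo (suc b)) ⟩
  sumℚ (map (λ i → sumℚ (map W? (prepend i))) (upTo (suc b)))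
    ≡⟨ sumℚ-map-applyUpTo (suc b) id (λ i → sumℚ (map W? (prepend i))) ⟩
  ∑< (suc b) (λ i → sumℚ (map W? (prepend i)))
    ≡⟨ ∑<-cong (suc b) (λ i _ → first-entry i) ⟩
  ∑< (suc b) (λ i → w i * evenBoxSum w n b (j ℕ.+ 2 ℕ.* i) r) ∎
  where
  W : ∀ {m} → Vec.Vec ℕ m → ℚ
  W v = vprodℚ (Vec.map w v)
  P? = λ (v : Vec.Vec ℕ (suc n)) → j ℕ.+ 2 ℕ.* vsum v ℕ.≟ r
  W? = λ v → if does (P? v) then W v else 0ℚ
  prepend = λ i → map (i Vec.∷_) (box n b)
  first-entry : ∀ i → sumℚ (map W? (prepend i)) ≡ w i * evenBoxSum w n b (j ℕ.+ 2 ℕ.* i) r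
  first-entry i = begin
    sumℚ (map W? (map (i Vec.∷_) (box n b)))                    ≡⟨ cong sumℚ (List.map-∘ (box n b)) ⟨
    sumℚ (map (W? ∘ (i Vec.∷_)) (box n b))                      ≡⟨ sumℚ-map-cong entry (box n b) ⟩
    sumℚ (map (λ v → w i * Q? v) (box n b))                     ≡⟨ sumℚ-map-*ˡ (w i) Q? (box n b) ⟩
    w i * sumℚ (map Q? (box n b))                               ≡⟨ cong (w i *_) (sumℚ-map-filter Q W (box n b)) ⟨
    w i * evenBoxSum w n b (j ℕ.+ 2 ℕ.* i) r                    ∎
    where
    Q = λ (v : Vec.Vec ℕ n) → j ℕ.+ 2 ℕ.* i ℕ.+ 2 ℕ.* vsum v ℕ.≟ r
    Q? = λ v → if does (Q v) then W v else 0ℚ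
    entry : ∀ v → W? (i Vec.∷ v) ≡ w i * Q? v
    entry v = trans (cong (λ m → if does (m ℕ.≟ r) then w i * W v else 0ℚ) regroup) (if-*ʳ (does (Q v)) (w i) (W v))
      where
      regroup : j ℕ.+ 2 ℕ.* (i ℕ.+ vsum v) ≡ j ℕ.+ 2 ℕ.* i ℕ.+ 2 ℕ.* vsum v
      regroup = trans (cong (j ℕ.+_) (ℕ.*-distribˡ-+ 2 i (vsum v))) (sym (ℕ.+-assoc j (2 ℕ.* i) (2 ℕ.* vsum v)))

⊛-even-coeff : ∀ g f → (∀ i → g (suc (2 ℕ.* i)) ≡ 0ℚ) → ∀ {b m} → m ≤ 2 ℕ.* b →
  (g ⊛ f) m ≡ ∑< (suc b) (λ i → g (2 ℕ.* i) * (X ^ˢ (2 ℕ.* i) ⊛ f) m)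
⊛-even-coeff g f g-odd≡0 {b} {m} m≤2b = begin
  (g ⊛ f) m
    ≡⟨ ⊛-coeff g f m ⟩
  ∑< (suc m) (λ k → g k * f (m ∸ k))
    ≡⟨ ∑<-cong (suc m) (λ k k<1+m → cong (g k *_) (X^ˢ-⊛-≤ f (ℕ.≤-pred k<1+m))) ⟨
  ∑< (suc m) term
    ≡⟨ ∑<-extend term 1+m≤2+2b (λ k 1+m≤k → trans (cong (g k *_) (X^ˢ-⊛-< f 1+m≤k)) (ℚ.*-zeroʳ (g k))) ⟨
  ∑< (2 ℕ.* suc b) term
    ≡⟨ ∑<-pairs (suc b) term ⟩
  ∑< (suc b) (λ i → term (2 ℕ.* i) + term (suc (2 ℕ.* i)))
    ≡⟨ ∑<-cong (suc b) (λ i _ → trans (cong (term (2 ℕ.* i) +_) (odd-term≡0 i)) (ℚ.+-identityʳ (term (2 ℕ.* i)))) ⟩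
  ∑< (suc b) (λ i → term (2 ℕ.* i)) ∎
  where
  term = λ k → g k * (X ^ˢ k ⊛ f) m
  1+m≤2+2b : suc m ≤ 2 ℕ.* suc b
  1+m≤2+2b = ℕ.≤-trans (s≤s (ℕ.m≤n⇒m≤1+n m≤2b)) (ℕ.≤-reflexive (sym (ℕ.*-suc 2 b)))
  odd-term≡0 : ∀ i → term (suc (2 ℕ.* i)) ≡ 0ℚ
  odd-term≡0 i = trans (cong (_* (X ^ˢ suc (2 ℕ.* i) ⊛ f) m) (g-odd≡0 i)) (ℚ.*-zeroˡ ((X ^ˢ suc (2 ℕ.* i) ⊛ f) m))

∑<-even-X^ˢ-⊛ : ∀ g f → (∀ i → g (suc (2 ℕ.* i)) ≡ 0ℚ) → ∀ b j r → r ≤ j ℕ.+ 2 ℕ.* b →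
  ∑< (suc b) (λ i → g (2 ℕ.* i) * (X ^ˢ (j ℕ.+ 2 ℕ.* i) ⊛ f) r) ≡ (X ^ˢ j ⊛ (g ⊛ f)) r
∑<-even-X^ˢ-⊛ g f g-odd≡0 b j r r≤j+2b with j ℕ.≤? r
... | yes j≤r = subst (λ r → ∑< (suc b) (λ i → g (2 ℕ.* i) * (X ^ˢ (j ℕ.+ 2 ℕ.* i) ⊛ f) r) ≡ (X ^ˢ j ⊛ (g ⊛ f)) r)
                      (ℕ.m+[n∸m]≡n j≤r) (shifted (r ∸ j) m≤2b)
  where
  m≤2b : r ∸ j ≤ 2 ℕ.* b
  m≤2b = ℕ.≤-trans (ℕ.∸-monoˡ-≤ j r≤j+2b) (ℕ.≤-reflexive (ℕ.m+n∸m≡n j (2 ℕ.* b)))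
  shifted : ∀ m → m ≤ 2 ℕ.* b →
    ∑< (suc b) (λ i → g (2 ℕ.* i) * (X ^ˢ (j ℕ.+ 2 ℕ.* i) ⊛ f) (j ℕ.+ m)) ≡ (X ^ˢ j ⊛ (g ⊛ f)) (j ℕ.+ m)
  shifted m m≤2b = begin
    ∑< (suc b) (λ i → g (2 ℕ.* i) * (X ^ˢ (j ℕ.+ 2 ℕ.* i) ⊛ f) (j ℕ.+ m))
      ≡⟨ ∑<-cong (suc b) (λ i _ → cong (g (2 ℕ.* i) *_) (X^ˢ-⊛-+ j (2 ℕ.* i) f m)) ⟩
    ∑< (suc b) (λ i → g (2 ℕ.* i) * (X ^ˢ (2 ℕ.* i) ⊛ f) m)
      ≡⟨ ⊛-even-coeff g f g-odd≡0 {b} m≤2b ⟨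
    (g ⊛ f) m
      ≡⟨ X^ˢ-⊛-shift j (g ⊛ f) m ⟨
    (X ^ˢ j ⊛ (g ⊛ f)) (j ℕ.+ m) ∎
... | no j≰r = begin
  ∑< (suc b) (λ i → g (2 ℕ.* i) * (X ^ˢ (j ℕ.+ 2 ℕ.* i) ⊛ f) r)
    ≡⟨ ∑<-zero (suc b) (λ i _ → trans (cong (g (2 ℕ.* i) *_) (X^ˢ-⊛-< f (ℕ.<-≤-trans r<j (ℕ.m≤m+n j (2 ℕ.* i)))))
                                      (ℚ.*-zeroʳ (g (2 ℕ.* i)))) ⟩
  0ℚ
    ≡⟨ X^ˢ-⊛-< (g ⊛ f) r<j ⟨
  (X ^ˢ j ⊛ (g ⊛ f)) r ∎
  where
  r<j = ℕ.≰⇒> j≰r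

evenBoxSum≡coeff : ∀ w g → (∀ i → w i ≡ g (2 ℕ.* i)) → (∀ i → g (suc (2 ℕ.* i)) ≡ 0ℚ) →
  ∀ n b j r → r ≤ j ℕ.+ 2 ℕ.* b → evenBoxSum w n b j r ≡ (X ^ˢ j ⊛ g ^ˢ n) r
evenBoxSum≡coeff w g w≡g-even g-odd≡0 zero b j r _ = evenBoxSum-zero w b j r
evenBoxSum≡coeff w g w≡g-even g-odd≡0 (suc n) b j r r≤j+2b = begin
  evenBoxSum w (suc n) b j r
    ≡⟨ evenBoxSum-suc w n b j r ⟩
  ∑< (suc b) (λ i → w i * evenBoxSum w n b (j ℕ.+ 2 ℕ.* i) r)
    ≡⟨ ∑<-cong (suc b) (λ i _ → cong₂ _*_ (w≡g-even i) (ih i)) ⟩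
  ∑< (suc b) (λ i → g (2 ℕ.* i) * (X ^ˢ (j ℕ.+ 2 ℕ.* i) ⊛ g ^ˢ n) r)
    ≡⟨ ∑<-even-X^ˢ-⊛ g (g ^ˢ n) g-odd≡0 b j r r≤j+2b ⟩
  (X ^ˢ j ⊛ g ^ˢ suc n) r ∎
  where
  ih : ∀ i → evenBoxSum w n b (j ℕ.+ 2 ℕ.* i) r ≡ (X ^ˢ (j ℕ.+ 2 ℕ.* i) ⊛ g ^ˢ n) r
  ih i = evenBoxSum≡coeff w g w≡g-even g-odd≡0 n b (j ℕ.+ 2 ℕ.* i) r
           (ℕ.≤-trans r≤j+2b (ℕ.+-monoˡ-≤ (2 ℕ.* b) (ℕ.m≤m+n j (2 ℕ.* i))))

d≡coeff : ∀ r j → d r j ≡ (X ^ˢ j ⊛ h ^ˢ r) r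
d≡coeff r j = evenBoxSum≡coeff (λ i → B (2 ℕ.* i) * invFact (2 ℕ.* i)) h h-even h-odd≡0 r r j r
                (ℕ.≤-trans (ℕ.m≤n*m r 2) (ℕ.m≤n+m (2 ℕ.* r) j))
  where
  X-even : ∀ i → X (2 ℕ.* i) ≡ 0ℚ
  X-even zero = refl
  X-even (suc i) = cong X (ℕ.*-suc 2 i)
  h-even : ∀ i → B (2 ℕ.* i) * invFact (2 ℕ.* i) ≡ h (2 ℕ.* i)
  h-even i = sym (begin
    β (2 ℕ.* i) + (const ½ ⊛ X) (2 ℕ.* i)
      ≡⟨ cong (β (2 ℕ.* i) +_) (trans (const-⊛ ½ X (2 ℕ.* i)) (cong (½ *_) (X-even i))) ⟩
    β (2 ℕ.* i) + ½ * 0ℚ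
      ≡⟨ ℚ.+-identityʳ (β (2 ℕ.* i)) ⟩
    β (2 ℕ.* i) ∎)

θ-X^ˢ⊛h^ˢ : ∀ k r → θ (X ^ˢ k ⊛ h ^ˢ suc r) ≗ const (ℕ→ℚ k) ⊛ (X ^ˢ k ⊛ h ^ˢ suc r)
  ⊕ const (ℕ→ℚ (suc r)) ⊛ (X ^ˢ k ⊛ h ^ˢ suc r ⊝ X ^ˢ k ⊛ h ^ˢ suc (suc r) ⊕ const ¼ ⊛ (X ⊛ (X ⊛ (X ^ˢ k ⊛ h ^ˢ r))))
θ-X^ˢ⊛h^ˢ k r n = begin
  θ (Y ⊛ (h ⊛ H)) n
    ≡⟨ θ-leibniz Y (h ⊛ H) n ⟩
  (θ Y ⊛ (h ⊛ H) ⊕ Y ⊛ θ (h ⊛ H)) n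
    ≡⟨ cong₂ _+_ (⊛-cong (θ-X^ˢ k) (λ _ → refl) n)
                 (⊛-cong (λ _ → refl) (λ m → trans (θ-^ˢ h r m) (⊛-cong (λ _ → refl) (⊛-cong h-riccati (λ _ → refl)) m)) n) ⟩
  (Kk ⊛ Y ⊛ (h ⊛ H) ⊕ Y ⊛ (Kr ⊛ ((h ⊝ h ⊛ h ⊕ const ¼ ⊛ (X ⊛ X)) ⊛ H))) n
    ≡⟨ solve 7 (λ kk kr q y g gs x → kk :* y :* (g :* gs) :+ y :* (kr :* ((g :- g :* g :+ q :* (x :* x)) :* gs))
                                 := kk :* (y :* (g :* gs)) :+ kr :* (y :* (g :* gs) :- y :* (g :* (g :* gs)) :+ q :* (x :* (x :* (y :* gs)))))
               (λ _ → refl) Kk Kr (const ¼) Y h H X n ⟩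
  (Kk ⊛ (Y ⊛ (h ⊛ H)) ⊕ Kr ⊛ (Y ⊛ (h ⊛ H) ⊝ Y ⊛ (h ⊛ (h ⊛ H)) ⊕ const ¼ ⊛ (X ⊛ (X ⊛ (Y ⊛ H))))) n ∎
  where
  open ⊛-Solver
  Y = X ^ˢ k
  H = h ^ˢ r
  Kk = const (ℕ→ℚ k)
  Kr = const (ℕ→ℚ (suc r))

-- The coefficient of x^(r+2) in θ-X^ˢ⊛h^ˢ (j + 1) r, on whose left side θ is multiplication by r + 2.
d-recurrence : ∀ r j → ℕ→ℚ (suc r) * d (suc (suc r)) (suc j) ≡ ℕ→ℚ j * d (suc r) j + ℕ→ℚ (suc r) * (¼ * d r (suc j))
d-recurrence r j = begin
  Rℚ * d (suc (suc r)) (suc j)                ≡⟨ cong (Rℚ *_) v≡d ⟨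
  Rℚ * v                                      ≡⟨ +-cancelʳ t (Rℚ * v) (Jℚ * u + Rℚ * (¼ * w)) balance ⟩
  Jℚ * u + Rℚ * (¼ * w)                       ≡⟨ cong₂ (λ x y → Jℚ * x + Rℚ * (¼ * y)) u≡d w≡d ⟩
  Jℚ * d (suc r) j + Rℚ * (¼ * d r (suc j))   ∎
  where
  open ℚ-Solver
  Rℚ = ℕ→ℚ (suc r)
  Jℚ = ℕ→ℚ j
  Y = X ^ˢ suc j
  H = h ^ˢ r
  u = (Y ⊛ h ^ˢ suc r) (suc (suc r))
  v = (Y ⊛ h ^ˢ suc (suc r)) (suc (suc r))
  w = (X ⊛ (X ⊛ (Y ⊛ H))) (suc (suc r))
  t = (1ℚ + Jℚ) * u + Rℚ * (u + - v + ¼ * w)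
  u≡d : u ≡ d (suc r) j
  u≡d = trans (X^ˢ-⊛-suc j (h ^ˢ suc r) (suc r)) (sym (d≡coeff (suc r) j))
  v≡d : v ≡ d (suc (suc r)) (suc j)
  v≡d = sym (d≡coeff (suc (suc r)) (suc j))
  w≡d : w ≡ d r (suc j)
  w≡d = trans (X-⊛-suc (X ⊛ (Y ⊛ H)) (suc r)) (trans (X-⊛-suc (Y ⊛ H) r) (sym (d≡coeff r (suc j))))
  rest = Y ⊛ h ^ˢ suc r ⊝ Y ⊛ h ^ˢ suc (suc r) ⊕ const ¼ ⊛ (X ⊛ (X ⊛ (Y ⊛ H)))
  coefficient : (1ℚ + Rℚ) * u ≡ t
  coefficient = begin
    (1ℚ + Rℚ) * u
      ≡⟨ cong (_* u) (ℕ→ℚ-suc (suc r)) ⟨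
    θ (Y ⊛ h ^ˢ suc r) (suc (suc r))
      ≡⟨ θ-X^ˢ⊛h^ˢ (suc j) r (suc (suc r)) ⟩
    (const (ℕ→ℚ (suc j)) ⊛ (Y ⊛ h ^ˢ suc r)) (suc (suc r)) + (const Rℚ ⊛ rest) (suc (suc r))
      ≡⟨ cong₂ _+_ (const-⊛ (ℕ→ℚ (suc j)) (Y ⊛ h ^ˢ suc r) (suc (suc r))) (const-⊛ Rℚ rest (suc (suc r))) ⟩
    ℕ→ℚ (suc j) * u + Rℚ * (u + - v + (const ¼ ⊛ (X ⊛ (X ⊛ (Y ⊛ H)))) (suc (suc r)))
      ≡⟨ cong₂ (λ x y → x * u + Rℚ * (u + - v + y)) (ℕ→ℚ-suc j) (const-⊛ ¼ (X ⊛ (X ⊛ (Y ⊛ H))) (suc (suc r))) ⟩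
    t ∎
  balance : Rℚ * v + t ≡ Jℚ * u + Rℚ * (¼ * w) + t
  balance = begin
    Rℚ * v + t
      ≡⟨ solve 5 (λ ρ ι x y z → ρ :* y :+ ((con 1ℚ :+ ι) :* x :+ ρ :* (x :- y :+ con ¼ :* z))
                 := ι :* x :+ ρ :* (con ¼ :* z) :+ (con 1ℚ :+ ρ) :* x) refl Rℚ Jℚ u v w ⟩
    Jℚ * u + Rℚ * (¼ * w) + (1ℚ + Rℚ) * u
      ≡⟨ cong (Jℚ * u + Rℚ * (¼ * w) +_) coefficient ⟩
    Jℚ * u + Rℚ * (¼ * w) + t ∎

cSum-vanishes : ∀ {r j} → r < j → cSum r j ≡ 0ℚ
cSum-vanishes {r} {j} r<j = cong (λ n → sumℚ (map (λ i → summand (j ℕ.+ i)) (applyUpTo id n))) (ℕ.m≤n⇒m∸n≡0 r<j)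
  where summand = λ k → ((- ℕ→ℚ 2) ^ℚ (k ∸ j)) * invFact (k ∸ 1) * ℕ→ℚ (r C k) * ℕ→ℚ (S k j)

-- Scaled by 2^j so as to avoid 2^(r - j), whose truncated subtraction would misbehave for
-- r < j, a case the induction passes through.
cSum≡d : ∀ r j → ℕ→ℚ 2 ^ℚ suc j * cSum r (suc j) ≡ ℕ→ℚ 2 ^ℚ r * invFact j * d r (suc j)
cSum≡d zero j = begin
  ℕ→ℚ 2 ^ℚ suc j * cSum 0 (suc j)    ≡⟨ cong (ℕ→ℚ 2 ^ℚ suc j *_) (cSum-vanishes {0} {suc j} (s≤s z≤n)) ⟩
  ℕ→ℚ 2 ^ℚ suc j * 0ℚ                ≡⟨ ℚ.*-zeroʳ (ℕ→ℚ 2 ^ℚ suc j) ⟩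
  0ℚ                                 ≡⟨ ℚ.*-zeroʳ (1ℚ * invFact j) ⟨
  1ℚ * invFact j * 0ℚ                ≡⟨ cong (1ℚ * invFact j *_) (trans (d≡coeff 0 (suc j)) (X^ˢ-⊛-zero j 𝟙)) ⟨
  1ℚ * invFact j * d 0 (suc j)       ∎
cSum≡d (suc zero) zero = refl
cSum≡d (suc zero) (suc j) = begin
  ℕ→ℚ 2 ^ℚ suc (suc j) * cSum 1 (suc (suc j))
    ≡⟨ cong (ℕ→ℚ 2 ^ℚ suc (suc j) *_) (cSum-vanishes {1} {suc (suc j)} (s≤s (s≤s z≤n))) ⟩
  ℕ→ℚ 2 ^ℚ suc (suc j) * 0ℚ
    ≡⟨ ℚ.*-zeroʳ (ℕ→ℚ 2 ^ℚ suc (suc j)) ⟩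
  0ℚ
    ≡⟨ ℚ.*-zeroʳ (ℕ→ℚ 2 ^ℚ 1 * invFact (suc j)) ⟨
  ℕ→ℚ 2 ^ℚ 1 * invFact (suc j) * 0ℚ
    ≡⟨ cong (ℕ→ℚ 2 ^ℚ 1 * invFact (suc j) *_)
            (trans (d≡coeff 1 (suc (suc j))) (X^ˢ-⊛-< {suc (suc j)} (h ^ˢ 1) (s≤s (s≤s z≤n)))) ⟨
  ℕ→ℚ 2 ^ℚ 1 * invFact (suc j) * d 1 (suc (suc j)) ∎
cSum≡d (suc (suc r)) zero = begin
  ℕ→ℚ 2 ^ℚ 1 * cSum (suc (suc r)) 1
    ≡⟨ cong (ℕ→ℚ 2 ^ℚ 1 *_) (cSum-recurrence₁ r) ⟩
  ℕ→ℚ 2 ^ℚ 1 * cSum r 1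
    ≡⟨ cSum≡d r zero ⟩
  ℕ→ℚ 2 ^ℚ r * invFact 0 * d r 1
    ≡⟨ solve 2 (λ p x → p :* con 1ℚ :* x := con (ℕ→ℚ 2) :* (con (ℕ→ℚ 2) :* p) :* con 1ℚ :* (con ¼ :* x))
               refl (ℕ→ℚ 2 ^ℚ r) (d r 1) ⟩
  ℕ→ℚ 2 ^ℚ suc (suc r) * invFact 0 * (¼ * d r 1)
    ≡⟨ cong (ℕ→ℚ 2 ^ℚ suc (suc r) * invFact 0 *_) quarter ⟨
  ℕ→ℚ 2 ^ℚ suc (suc r) * invFact 0 * d (suc (suc r)) 1 ∎
  where
  open ℚ-Solver
  quarter : d (suc (suc r)) 1 ≡ ¼ * d r 1
  quarter = ℕ→ℚ-*-cancelˡ (suc r) (begin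
    ℕ→ℚ (suc r) * d (suc (suc r)) 1                        ≡⟨ d-recurrence r 0 ⟩
    0ℚ * d (suc r) 0 + ℕ→ℚ (suc r) * (¼ * d r 1)           ≡⟨ cong (_+ ℕ→ℚ (suc r) * (¼ * d r 1)) (ℚ.*-zeroˡ (d (suc r) 0)) ⟩
    0ℚ + ℕ→ℚ (suc r) * (¼ * d r 1)                         ≡⟨ ℚ.+-identityˡ _ ⟩
    ℕ→ℚ (suc r) * (¼ * d r 1)                              ∎)
cSum≡d (suc (suc r)) (suc j) = ℕ→ℚ-*-cancelˡ (suc r) (begin
  R * (two * P₁ * cSum (suc (suc r)) (suc (suc j)))
    ≡⟨ solve 4 (λ R t p x → R :* (t :* p :* x) := t :* p :* (R :* x)) refl R two P₁ (cSum (suc (suc r)) (suc (suc j))) ⟩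
  two * P₁ * (R * cSum (suc (suc r)) (suc (suc j)))
    ≡⟨ cong (two * P₁ *_) (cSum-recurrence r j) ⟩
  two * P₁ * (R * cSum r (suc (suc j)) + cSum (suc r) (suc j))
    ≡⟨ solve 5 (λ t p R x y → t :* p :* (R :* x :+ y) := R :* (t :* p :* x) :+ t :* (p :* y))
               refl two P₁ R (cSum r (suc (suc j))) (cSum (suc r) (suc j)) ⟩
  R * (two * P₁ * cSum r (suc (suc j))) + two * (P₁ * cSum (suc r) (suc j))
    ≡⟨ cong₂ (λ x y → R * x + two * y) (cSum≡d r (suc j)) (cSum≡d (suc r) j) ⟩
  R * (Q * f₁ * D₀) + two * (two * Q * invFact j * D₁)
    ≡⟨ cong (λ f → R * (Q * f₁ * D₀) + two * (two * Q * f * D₁)) (invFact-suc j) ⟨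
  R * (Q * f₁ * D₀) + two * (two * Q * (f₁ * J₁) * D₁)
    ≡⟨ solve 6 (λ R Q f J x y → R :* (Q :* f :* x) :+ con (ℕ→ℚ 2) :* (con (ℕ→ℚ 2) :* Q :* (f :* J) :* y)
                             := con (ℕ→ℚ 2) :* (con (ℕ→ℚ 2) :* Q) :* f :* (J :* y :+ R :* (con ¼ :* x))) refl R Q f₁ J₁ D₀ D₁ ⟩
  two * (two * Q) * f₁ * (J₁ * D₁ + R * (¼ * D₀))
    ≡⟨ cong (two * (two * Q) * f₁ *_) (d-recurrence r (suc j)) ⟨
  two * (two * Q) * f₁ * (R * d (suc (suc r)) (suc (suc j)))
    ≡⟨ solve 4 (λ p f R x → p :* f :* (R :* x) := R :* (p :* f :* x)) refl (two * (two * Q)) f₁ R (d (suc (suc r)) (suc (suc j))) ⟩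
  R * (two * (two * Q) * f₁ * d (suc (suc r)) (suc (suc j))) ∎)
  where
  open ℚ-Solver
  R = ℕ→ℚ (suc r)
  two = ℕ→ℚ 2
  P₁ = two ^ℚ suc j
  Q = two ^ℚ r
  f₁ = invFact (suc j)
  J₁ = ℕ→ℚ (suc j)
  D₀ = d r (suc (suc j))
  D₁ = d (suc r) (suc j)

cSum-closed-form : ∀ {r j} → suc j ≤ r → cSum r (suc j) ≡ ℕ→ℚ 2 ^ℚ (r ∸ suc j) * invFact j * d r (suc j)
cSum-closed-form {r} {j} j<r = ℕ→ℚ-*-cancelˡ (2 ℕ.^ suc j) {{ℕ.m^n≢0 2 (suc j)}} (begin
  ℕ→ℚ (2 ℕ.^ suc j) * cSum r (suc j)
    ≡⟨ cong (_* cSum r (suc j)) (ℕ→ℚ-^ 2 (suc j)) ⟨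
  ℕ→ℚ 2 ^ℚ suc j * cSum r (suc j)
    ≡⟨ cSum≡d r j ⟩
  ℕ→ℚ 2 ^ℚ r * invFact j * D
    ≡⟨ cong (λ n → ℕ→ℚ 2 ^ℚ n * invFact j * D) (ℕ.m+[n∸m]≡n j<r) ⟨
  ℕ→ℚ 2 ^ℚ (suc j ℕ.+ m) * invFact j * D
    ≡⟨ cong (λ x → x * invFact j * D) (^ℚ-+ (ℕ→ℚ 2) (suc j) m) ⟩
  P * ℕ→ℚ 2 ^ℚ m * invFact j * D
    ≡⟨ solve 4 (λ p q f x → p :* q :* f :* x := p :* (q :* f :* x)) refl P (ℕ→ℚ 2 ^ℚ m) (invFact j) D ⟩
  P * (ℕ→ℚ 2 ^ℚ m * invFact j * D)
    ≡⟨ cong (_* (ℕ→ℚ 2 ^ℚ m * invFact j * D)) (ℕ→ℚ-^ 2 (suc j)) ⟩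
  ℕ→ℚ (2 ℕ.^ suc j) * (ℕ→ℚ 2 ^ℚ m * invFact j * D) ∎)
  where
  open ℚ-Solver
  m = r ∸ suc j
  P = ℕ→ℚ 2 ^ℚ suc j
  D = d r (suc j)

theorem2 : (r j : ℕ) → 1 ≤ r → 1 ≤ j → j ≤ r → j % 2 ≡ r % 2 →
    c r j ≡ ((- 1ℚ) ^ℚ (r ℕ.+ 1)) * (ℕ→ℚ 2 ^ℚ (r ∸ j)) * invFact (j ∸ 1) * d r j
theorem2 zero j () _ _ _
theorem2 (suc r) zero _ () _ _
theorem2 (suc r) (suc j) _ _ j≤r _ = begin
  c (suc r) (suc j)
    ≡⟨⟩
  (- 1ℚ) ^ℚ r * cSum (suc r) (suc j)
    ≡⟨ cong ((- 1ℚ) ^ℚ r *_) (cSum-closed-form j≤r) ⟩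
  (- 1ℚ) ^ℚ r * (ℕ→ℚ 2 ^ℚ (r ∸ j) * invFact j * d (suc r) (suc j))
    ≡⟨ solve 4 (λ s p f x → s :* (p :* f :* x) := (:- con 1ℚ) :* ((:- con 1ℚ) :* s) :* p :* f :* x)
               refl ((- 1ℚ) ^ℚ r) (ℕ→ℚ 2 ^ℚ (r ∸ j)) (invFact j) (d (suc r) (suc j)) ⟩
  (- 1ℚ) ^ℚ suc (suc r) * ℕ→ℚ 2 ^ℚ (r ∸ j) * invFact j * d (suc r) (suc j)
    ≡⟨ cong (λ n → (- 1ℚ) ^ℚ n * ℕ→ℚ 2 ^ℚ (r ∸ j) * invFact j * d (suc r) (suc j)) (cong suc (ℕ.+-comm 1 r)) ⟩
  (- 1ℚ) ^ℚ (suc r ℕ.+ 1) * ℕ→ℚ 2 ^ℚ (r ∸ j) * invFact j * d (suc r) (suc j) ∎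
  where open ℚ-Solver
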